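{- For integers $n, m \geq 0$, let $cp_{1-1}(n, m)$ denote the number of partitions of $n$ into $m$ parts $\lambda_1 \leq \cdots \leq \lambda_m$ such that $\lambda_{i+1} - \lambda_i \geq 2$ for all $i$, and $\lambda_{i+1} - \lambda_i \geq 4$ unless $\lambda_i + \lambda_{i+1} \equiv 1 \pmod{3}$. Then \[ \sum_{m, n \geq 0} cp_{1-1}(n,m) q^n x^m = \sum_{n_1, n_2 \geq 0} \frac{ q^{6n_2^2 - 2n_2 + 2n_1^2 - n_1 + 6n_2 n_1} x^{2n_2 + n_1} }{ (q; q)_{n_1} (q^3; q^3)_{n_2} }. \]
   Context: A partition of $n$ into $m$ parts is a non-decreasing sequence of $m$ positive integers summing to $n$. For $n \geq 0$, $(a; q)_n = \prod_{j=1}^{n} (1 - a q^{j-1})$, with the empty product equal to $1$. -}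

module Defs where

open import Data.Nat as ℕ using (ℕ; zero; suc; _≤_; _≤?_; _%_; _≟_)
open import Data.Integer as ℤ using (ℤ; +_; -_)
open import Data.List using (List; []; _∷_; map; upTo; length; filter; zipWith; concatMap; foldr)
open import Data.Product using (_×_; _,_)
open import Data.Sum using (_⊎_)
open import Relation.Nullary using (Dec; yes; no)
open import Relation.Nullary.Decidable using (_⊎-dec_; _×-dec_)
open import Relation.Binary.PropositionalEquality using (_≡_)

boxLists : ℕ → ℕ → List (List ℕ)
boxLists zero    n = [] ∷ []
boxLists (suc m) n =
  concatMap (λ a → map (a ∷_) (boxLists m n)) (map suc (upTo n))

sumℕ : List ℕ → ℕ
sumℕ = foldr ℕ._+_ 0

GapOK : ℕ → ℕ → Set
GapOK a b = (a ℕ.+ 2 ≤ b) × ((a ℕ.+ 4 ≤ b) ⊎ ((a ℕ.+ b) % 3 ≡ 1))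

gapOK? : ∀ a b → Dec (GapOK a b)
gapOK? a b = (a ℕ.+ 2 ≤? b) ×-dec ((a ℕ.+ 4 ≤? b) ⊎-dec ((a ℕ.+ b) % 3 ≟ 1))

-- Non-decreasing (here automatically, as b ≥ a + 2) with the gap conditions
-- holding between all consecutive parts.
data Chain : List ℕ → Set where
  []  : Chain []
  [_] : ∀ a → Chain (a ∷ [])
  _∷_ : ∀ {a b l} → GapOK a b → Chain (b ∷ l) → Chain (a ∷ b ∷ l)

chain? : ∀ l → Dec (Chain l)
chain? []          = yes []
chain? (a ∷ [])    = yes [ a ]
chain? (a ∷ b ∷ l) with gapOK? a b | chain? (b ∷ l)
... | yes p | yes c = yes (p ∷ c)
... | no ¬p | _     = no λ { (p ∷ _) → ¬p p }
... | yes _ | no ¬c = no λ { (_ ∷ c) → ¬c c }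

-- A partition of n into m parts satisfying the 1-1 conditions
-- (parts are positive by construction of boxLists; length m by construction).
Valid : ℕ → List ℕ → Set
Valid n l = (sumℕ l ≡ n) × Chain l

valid? : ∀ n l → Dec (Valid n l)
valid? n l = (sumℕ l ≟ n) ×-dec chain? l

cp11 : ℕ → ℕ → ℕ
cp11 n m = length (filter (valid? n) (boxLists m n))

Series : Set
Series = ℕ → ℤ

sumℤ : List ℤ → ℤ
sumℤ = foldr ℤ._+_ (+ 0)

_⊛_ : Series → Series → Series
(f ⊛ g) n = sumℤ (map (λ k → f k ℤ.* g (n ℕ.∸ k)) (upTo (suc n)))

_⊕_ : Series → Series → Series
(f ⊕ g) n = f n ℤ.+ g n

_⊖_ : Series → Series → Series
(f ⊖ g) n = f n ℤ.- g n

zeroS : Series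
zeroS _ = + 0

mono : ℕ → Series
mono e n with n ≟ e
... | yes _ = + 1
... | no _  = + 0

oneS : Series
oneS = mono 0

-- (q^a ; q^b)_n = ∏_{j=1}^{n} (1 - q^a (q^b)^{j-1})
qPoch : ℕ → ℕ → ℕ → Series
qPoch a b zero    = oneS
qPoch a b (suc n) = qPoch a b n ⊛ (oneS ⊖ mono (a ℕ.+ b ℕ.* n))

-- Multiplicative inverse of a series f with constant term 1:
-- g₀ = 1, g_{n} = - Σ_{k=1}^{n} f_k g_{n-k}.
-- invRev f n = [g_n, g_{n-1}, …, g_0].
invRev : Series → ℕ → List ℤ
invRev f zero    = + 1 ∷ []
invRev f (suc n) =
  let prev = invRev f n in
  (- sumℤ (zipWith (λ k g → f (suc k) ℤ.* g) (upTo (suc n)) prev)) ∷ prev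

headOr0 : List ℤ → ℤ
headOr0 []      = + 0
headOr0 (x ∷ _) = x

inv : Series → Series
inv f n = headOr0 (invRev f n)

sumS : List Series → Series
sumS = foldr _⊕_ zeroS

-- exponent 6n2²-2n2+2n1²-n1+6n2n1 (always ≥ 0, so truncated subtraction is exact)
rhsExp : ℕ → ℕ → ℕ
rhsExp n1 n2 =
  (6 ℕ.* n2 ℕ.* n2 ℕ.+ 2 ℕ.* n1 ℕ.* n1 ℕ.+ 6 ℕ.* n2 ℕ.* n1) ℕ.∸ (2 ℕ.* n2 ℕ.+ n1)

rhsTerm : ℕ → ℕ → Series
rhsTerm n1 n2 = mono (rhsExp n1 n2) ⊛ inv (qPoch 1 1 n1 ⊛ qPoch 3 3 n2)

pairsX : ℕ → List (ℕ × ℕ)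
pairsX m = filter (λ p → 2 ℕ.* proj₂′ p ℕ.+ proj₁′ p ≟ m)
                  (concatMap (λ n1 → map (n1 ,_) (upTo (suc m))) (upTo (suc m)))
  where
  proj₁′ : ℕ × ℕ → ℕ
  proj₁′ (a , _) = a
  proj₂′ : ℕ × ℕ → ℕ
  proj₂′ (_ , b) = b

rhsCoeffX : ℕ → Series
rhsCoeffX m = sumS (map (λ { (n1 , n2) → rhsTerm n1 n2 }) (pairsX m))

lhsCoeffX : ℕ → Series
lhsCoeffX m n = + cp11 n m

module Submission where

-- Both sides are families of q-series indexed by the exponent m of x.  On the partition
-- side let Fᵣ(m) count the admissible chains of m parts whose first part is at least r.
-- Splitting off the first part, and lowering all parts by 3 (which preserves the gap
-- conditions, the sum of two parts dropping by 6), gives F₁(0) = F₂(0) = F₃(0) = 1 and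
--   F₃(m+1) = q^(3m+3) F₁(m+1) + q^(6m+3) F₁(m),
--   F₂(m+1) = F₃(m+1) + q^(3m+2) F₂(m),
--   F₁(m+1) + q^(3m+1) F₁(m) = F₂(m+1) + q^(3m+1) F₂(m) + q F₃(m).
-- On the sum side, multiplying by 1 - q^(n₁) or 1 - q^(3 n₂) gives two recurrences for
-- 1 / ((q;q)_(n₁) (q³;q³)_(n₂)), from which the right-hand side twisted by q^(α n₂ + β n₁)
-- satisfies the same system for (α, β) = (0,0), (3,1), (6,2).  The system has only one
-- solution: eliminating F₂(m+1) and F₃(m+1) expresses F₁(m+1) through q^(3m+3) F₁(m+1) and
-- level-m data, which fixes its coefficients one after another.

open import Defs
open import Data.Nat as ℕ using (ℕ; zero; suc; _≤_; _<_; z≤n; s≤s; _≤?_; _≤ᵇ_; _≡ᵇ_; _∸_; _+_; _*_; _%_)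
import Data.Nat.Properties as NP
open import Data.Nat.DivMod using ([m+kn]%n≡m%n)
open import Data.Integer using (ℤ; +_; -_) renaming (_+_ to _+z_; _*_ to _*z_; _-_ to _-z_)
import Data.Integer.Properties as ZP
open import Data.List using (List; []; _∷_; map; upTo; applyUpTo; zipWith; filter; concatMap; _++_; length)
import Data.List.Properties as LP
open import Data.Bool using (Bool; true; false; if_then_else_; _∧_)
import Data.Bool.Properties as BP
open import Data.Product using (_×_; _,_; proj₁; proj₂)
open import Data.Sum using (inj₁; inj₂)
open import Relation.Binary.PropositionalEquality
open import Relation.Nullary using (Dec; yes; no; does; ¬_)
open import Relation.Nullary.Negation using (contradiction)
open import Relation.Nullary.Decidable using (dec-true; dec-false; does-⇔; _×-dec_)
open import Relation.Unary using (Pred; Decidable)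
open import Level using (Level)
open import Function.Bundles using (mk⇔)
open import Function using (_∘_)
import Data.Integer.Tactic.RingSolver as ℤ-Solver
import Data.Nat.Tactic.RingSolver as ℕ-Solver

-- Finite sums

∑ : (ℕ → ℤ) → ℕ → ℤ
∑ f zero    = + 0
∑ f (suc n) = f 0 +z ∑ (f ∘ suc) n

sumℤ-applyUpTo : ∀ (f : ℕ → ℤ) n → sumℤ (applyUpTo f n) ≡ ∑ f n
sumℤ-applyUpTo f zero    = refl
sumℤ-applyUpTo f (suc n) = cong (f 0 +z_) (sumℤ-applyUpTo (f ∘ suc) n)

sumℤ-map-upTo : ∀ (f : ℕ → ℤ) n → sumℤ (map f (upTo n)) ≡ ∑ f n
sumℤ-map-upTo f n = trans (cong sumℤ (LP.map-applyUpTo (λ x → x) f n)) (sumℤ-applyUpTo f n)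

∑-cong : ∀ {f g : ℕ → ℤ} n → (∀ k → k < n → f k ≡ g k) → ∑ f n ≡ ∑ g n
∑-cong zero    f≡g = refl
∑-cong (suc n) f≡g = cong₂ _+z_ (f≡g 0 (s≤s z≤n)) (∑-cong n (λ k k<n → f≡g (suc k) (s≤s k<n)))

∑-zero : ∀ {f : ℕ → ℤ} n → (∀ k → k < n → f k ≡ + 0) → ∑ f n ≡ + 0
∑-zero zero    f≡0 = refl
∑-zero (suc n) f≡0 = cong₂ _+z_ (f≡0 0 (s≤s z≤n)) (∑-zero n (λ k k<n → f≡0 (suc k) (s≤s k<n)))

∑-distrib-+ : ∀ (f g : ℕ → ℤ) n → ∑ (λ k → f k +z g k) n ≡ ∑ f n +z ∑ g n
∑-distrib-+ f g zero    = refl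
∑-distrib-+ f g (suc n) =
  trans (cong (f 0 +z g 0 +z_) (∑-distrib-+ (f ∘ suc) (g ∘ suc) n))
        (interchange (f 0) (g 0) (∑ (f ∘ suc) n) (∑ (g ∘ suc) n))
  where
  interchange : ∀ (a b c d : ℤ) → (a +z b) +z (c +z d) ≡ (a +z c) +z (b +z d)
  interchange = ℤ-Solver.solve-∀

∑-neg : ∀ (f : ℕ → ℤ) n → ∑ (λ k → - f k) n ≡ - ∑ f n
∑-neg f zero    = refl
∑-neg f (suc n) = trans (cong (- f 0 +z_) (∑-neg (f ∘ suc) n)) (sym (ZP.neg-distrib-+ (f 0) _))

∑-distrib-sub : ∀ (f g : ℕ → ℤ) n → ∑ (λ k → f k -z g k) n ≡ ∑ f n -z ∑ g n
∑-distrib-sub f g n = trans (∑-distrib-+ f (λ k → - g k) n) (cong (∑ f n +z_) (∑-neg g n))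

∑-suc : ∀ (f : ℕ → ℤ) n → ∑ f (suc n) ≡ ∑ f n +z f n
∑-suc f zero    = ZP.+-comm (f 0) (+ 0)
∑-suc f (suc n) = trans (cong (f 0 +z_) (∑-suc (f ∘ suc) n)) (sym (ZP.+-assoc (f 0) _ _))

∑-+ : ∀ (f : ℕ → ℤ) a b → ∑ f (a + b) ≡ ∑ f a +z ∑ (λ k → f (a + k)) b
∑-+ f zero    b = sym (ZP.+-identityˡ _)
∑-+ f (suc a) b = trans (cong (f 0 +z_) (∑-+ (f ∘ suc) a b)) (sym (ZP.+-assoc (f 0) _ _))

∑-reverse : ∀ (f : ℕ → ℤ) n → ∑ f n ≡ ∑ (λ k → f (n ∸ suc k)) n
∑-reverse f zero    = refl
∑-reverse f (suc n) =
  trans (∑-suc f n) (trans (cong (_+z f n) (∑-reverse f n)) (ZP.+-comm _ (f n)))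

∑-single : ∀ {f : ℕ → ℤ} n j → j < n → (∀ k → k < n → k ≢ j → f k ≡ + 0) → ∑ f n ≡ f j
∑-single {f} (suc n) zero j<n f≡0 =
  trans (cong (f 0 +z_) (∑-zero n (λ k k<n → f≡0 (suc k) (s≤s k<n) (λ ()))))
        (ZP.+-identityʳ _)
∑-single {f} (suc n) (suc j) (s≤s j<n) f≡0 =
  trans (cong (_+z ∑ (f ∘ suc) n) (f≡0 0 (s≤s z≤n) (λ ())))
        (trans (ZP.+-identityˡ _)
               (∑-single n j j<n (λ k k<n k≢j → f≡0 (suc k) (s≤s k<n) (k≢j ∘ NP.suc-injective))))

∑-swap : ∀ (F : ℕ → ℕ → ℤ) a b → ∑ (λ i → ∑ (F i) b) a ≡ ∑ (λ j → ∑ (λ i → F i j) a) b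
∑-swap F zero    b = sym (∑-zero b (λ _ _ → refl))
∑-swap F (suc a) b =
  trans (cong (∑ (F 0) b +z_) (∑-swap (F ∘ suc) a b))
        (sym (∑-distrib-+ (F 0) (λ j → ∑ (λ i → F (suc i) j) a) b))

∑-truncate : ∀ (f : ℕ → ℤ) n N → n ≤ N → (∀ k → n ≤ k → k < N → f k ≡ + 0) → ∑ f N ≡ ∑ f n
∑-truncate f n N n≤N f≡0 = begin
  ∑ f N                                      ≡⟨ cong (∑ f) (sym (NP.m+[n∸m]≡n n≤N)) ⟩
  ∑ f (n + (N ∸ n))                          ≡⟨ ∑-+ f n (N ∸ n) ⟩
  ∑ f n +z ∑ (λ k → f (n + k)) (N ∸ n)       ≡⟨ cong (∑ f n +z_) (∑-zero (N ∸ n) tail≡0) ⟩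
  ∑ f n +z + 0                               ≡⟨ ZP.+-identityʳ _ ⟩
  ∑ f n                                      ∎
  where
  open ≡-Reasoning
  tail≡0 : ∀ k → k < N ∸ n → f (n + k) ≡ + 0
  tail≡0 k k<N∸n = f≡0 (n + k) (NP.m≤m+n n k)
    (subst (n + k <_) (NP.m+[n∸m]≡n n≤N) (NP.+-monoʳ-< n k<N∸n))

∑-drop-last : ∀ (f : ℕ → ℤ) n → f n ≡ + 0 → ∑ f (suc n) ≡ ∑ f n
∑-drop-last f n fₙ≡0 = trans (∑-suc f n) (trans (cong (∑ f n +z_) fₙ≡0) (ZP.+-identityʳ _))

≤ᵇ-true : ∀ {a b} → a ≤ b → (a ≤ᵇ b) ≡ true
≤ᵇ-true {a} {b} = dec-true (a ≤? b)

≤ᵇ-false : ∀ {a b} → ¬ a ≤ b → (a ≤ᵇ b) ≡ false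
≤ᵇ-false {a} {b} = dec-false (a ≤? b)

suc-≤ᵇ-suc : ∀ a b → (suc a ≤ᵇ suc b) ≡ (a ≤ᵇ b)
suc-≤ᵇ-suc zero    b = refl
suc-≤ᵇ-suc (suc a) b = refl

2*suc≰ : ∀ m → ¬ 2 * suc m ≤ m
2*suc≰ m 2*suc≤m = NP.<-irrefl refl (NP.≤-trans (NP.m≤m+n (suc m) (suc m + 0)) 2*suc≤m)

3*suc≰ : ∀ m j → j < 3 → ¬ 3 * suc m ≤ j
3*suc≰ m j j<3 3*suc≤j = NP.<⇒≱ j<3 (NP.≤-trans (NP.m≤m*n 3 (suc m)) 3*suc≤j)

-- Shifts and products of q-series

_≈_ : Series → Series → Set
f ≈ g = ∀ n → f n ≡ g n

shift : ℕ → Series → Series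
shift c f n with c ≤? n
... | yes _ = f (n ∸ c)
... | no _  = + 0

shift-≤ : ∀ c f n → c ≤ n → shift c f n ≡ f (n ∸ c)
shift-≤ c f n c≤n with c ≤? n
... | yes _   = refl
... | no c≰n = contradiction c≤n c≰n

shift-≰ : ∀ c f n → ¬ c ≤ n → shift c f n ≡ + 0
shift-≰ c f n c≰n with c ≤? n
... | yes c≤n = contradiction c≤n c≰n
... | no _    = refl

shift-0 : ∀ f → shift 0 f ≈ f
shift-0 f n = shift-≤ 0 f n z≤n

shift-cong : ∀ c {f g : Series} → f ≈ g → shift c f ≈ shift c g
shift-cong c f≈g n with c ≤? n
... | yes _ = f≈g _
... | no _  = refl

shift-cong-< : ∀ c (f g : Series) n → 1 ≤ c → (∀ k → k < n → f k ≡ g k) → shift c f n ≡ shift c g n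
shift-cong-< c f g n 1≤c f≡g with c ≤? n
... | yes c≤n = f≡g (n ∸ c) (NP.∸-monoʳ-< 1≤c c≤n)
... | no _    = refl

shift-⊕ : ∀ c f g → shift c (f ⊕ g) ≈ (shift c f ⊕ shift c g)
shift-⊕ c f g n with c ≤? n
... | yes _ = refl
... | no _  = refl

shift-∑ : ∀ c (F : ℕ → Series) N n →
          shift c (λ k → ∑ (λ i → F i k) N) n ≡ ∑ (λ i → shift c (F i) n) N
shift-∑ c F zero n with c ≤? n
... | yes _ = refl
... | no _  = refl
shift-∑ c F (suc N) n =
  trans (shift-⊕ c (F 0) (λ k → ∑ (λ i → F (suc i) k) N) n)
        (cong (shift c (F 0) n +z_) (shift-∑ c (F ∘ suc) N n))

shift-if : ∀ c (b : Bool) f n → shift c (λ k → if b then f k else + 0) n ≡ (if b then shift c f n else + 0)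
shift-if c true  f n = refl
shift-if c false f n with c ≤? n
... | yes _ = refl
... | no _  = refl

shift-shift : ∀ a b f → shift a (shift b f) ≈ shift (a + b) f
shift-shift a b f n with a ≤? n
... | no a≰n = sym (shift-≰ (a + b) f n (λ a+b≤n → a≰n (NP.≤-trans (NP.m≤m+n a b) a+b≤n)))
... | yes a≤n with b ≤? n ∸ a
...   | yes b≤n∸a = trans (cong f (NP.∸-+-assoc n a b)) (sym (shift-≤ (a + b) f n
                      (subst (a + b ≤_) (NP.m+[n∸m]≡n a≤n) (NP.+-monoʳ-≤ a b≤n∸a))))
...   | no b≰n∸a  = sym (shift-≰ (a + b) f n
                      (λ a+b≤n → b≰n∸a (subst (_≤ n ∸ a) (NP.m+n∸m≡n a b) (NP.∸-monoˡ-≤ a a+b≤n))))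

shift-+-index : ∀ a c f n → shift (a + c) f (a + n) ≡ shift c f n
shift-+-index a c f n with c ≤? n
... | yes c≤n = trans (shift-≤ (a + c) f (a + n) (NP.+-monoʳ-≤ a c≤n))
                      (cong f (NP.[m+n]∸[m+o]≡n∸o a n c))
... | no c≰n  = shift-≰ (a + c) f (a + n) (c≰n ∘ NP.+-cancelˡ-≤ a c n)

mono≈shift-oneS : ∀ c → mono c ≈ shift c oneS
mono≈shift-oneS c n with n ℕ.≟ c
... | yes refl = sym (trans (shift-≤ n oneS n NP.≤-refl) (cong oneS (NP.n∸n≡0 n)))
... | no n≢c with c ≤? n
...   | no _    = refl
...   | yes c≤n with n ∸ c in n∸c≡
...     | zero  = contradiction (trans (sym (NP.m∸n+n≡m c≤n)) (cong (_+ c) n∸c≡)) n≢c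
...     | suc _ = refl

⊛-as-∑ : ∀ f g n → (f ⊛ g) n ≡ ∑ (λ k → f k *z g (n ∸ k)) (suc n)
⊛-as-∑ f g n = sumℤ-map-upTo (λ k → f k *z g (n ∸ k)) (suc n)

⊛-at-0 : ∀ f g → (f ⊛ g) 0 ≡ f 0 *z g 0
⊛-at-0 f g = trans (⊛-as-∑ f g 0) (ZP.+-identityʳ _)

⊛-cong : ∀ {f f′ g g′} → f ≈ f′ → g ≈ g′ → (f ⊛ g) ≈ (f′ ⊛ g′)
⊛-cong {f} {f′} {g} {g′} f≈f′ g≈g′ n = begin
  (f ⊛ g) n                             ≡⟨ ⊛-as-∑ f g n ⟩
  ∑ (λ k → f k *z g (n ∸ k)) (suc n)    ≡⟨ ∑-cong (suc n) (λ k _ → cong₂ _*z_ (f≈f′ k) (g≈g′ (n ∸ k))) ⟩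
  ∑ (λ k → f′ k *z g′ (n ∸ k)) (suc n)  ≡⟨ ⊛-as-∑ f′ g′ n ⟨
  (f′ ⊛ g′) n                           ∎
  where open ≡-Reasoning

⊛-comm : ∀ f g → (f ⊛ g) ≈ (g ⊛ f)
⊛-comm f g n = begin
  (f ⊛ g) n                                           ≡⟨ ⊛-as-∑ f g n ⟩
  ∑ (λ k → f k *z g (n ∸ k)) (suc n)                  ≡⟨ ∑-reverse (λ k → f k *z g (n ∸ k)) (suc n) ⟩
  ∑ (λ k → f (n ∸ k) *z g (n ∸ (n ∸ k))) (suc n)      ≡⟨ ∑-cong (suc n) swap ⟩
  ∑ (λ k → g k *z f (n ∸ k)) (suc n)                  ≡⟨ ⊛-as-∑ g f n ⟨
  (g ⊛ f) n                                           ∎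
  where
  open ≡-Reasoning
  swap : ∀ k → k < suc n → f (n ∸ k) *z g (n ∸ (n ∸ k)) ≡ g k *z f (n ∸ k)
  swap k k<1+n = trans (ZP.*-comm (f (n ∸ k)) _)
                       (cong (λ i → g i *z f (n ∸ k)) (NP.m∸[m∸n]≡n (NP.≤-pred k<1+n)))

⊛-distribʳ-⊖ : ∀ f g h → ((f ⊖ g) ⊛ h) ≈ ((f ⊛ h) ⊖ (g ⊛ h))
⊛-distribʳ-⊖ f g h n = begin
  ((f ⊖ g) ⊛ h) n
    ≡⟨ ⊛-as-∑ (f ⊖ g) h n ⟩
  ∑ (λ k → (f k -z g k) *z h (n ∸ k)) (suc n)
    ≡⟨ ∑-cong (suc n) (λ k _ → distribʳ-sub (f k) (g k) (h (n ∸ k))) ⟩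
  ∑ (λ k → f k *z h (n ∸ k) -z g k *z h (n ∸ k)) (suc n)
    ≡⟨ ∑-distrib-sub (λ k → f k *z h (n ∸ k)) (λ k → g k *z h (n ∸ k)) (suc n) ⟩
  ∑ (λ k → f k *z h (n ∸ k)) (suc n) -z ∑ (λ k → g k *z h (n ∸ k)) (suc n)
    ≡⟨ cong₂ _-z_ (⊛-as-∑ f h n) (⊛-as-∑ g h n) ⟨
  ((f ⊛ h) ⊖ (g ⊛ h)) n
    ∎
  where
  open ≡-Reasoning
  distribʳ-sub : ∀ (a b c : ℤ) → (a -z b) *z c ≡ a *z c -z b *z c
  distribʳ-sub = ℤ-Solver.solve-∀

⊛-distribˡ-⊖ : ∀ f g h → (f ⊛ (g ⊖ h)) ≈ ((f ⊛ g) ⊖ (f ⊛ h))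
⊛-distribˡ-⊖ f g h n = trans (⊛-comm f (g ⊖ h) n) (trans (⊛-distribʳ-⊖ g h f n)
  (cong₂ _-z_ (⊛-comm g f n) (⊛-comm h f n)))

⊛-identityˡ : ∀ g → (oneS ⊛ g) ≈ g
⊛-identityˡ g n = trans (⊛-as-∑ oneS g n) (trans
  (cong₂ _+z_ (ZP.*-identityˡ (g n)) (∑-zero n (λ k _ → ZP.*-zeroˡ (g (n ∸ suc k)))))
  (ZP.+-identityʳ (g n)))

⊛-identityʳ : ∀ g → (g ⊛ oneS) ≈ g
⊛-identityʳ g n = trans (⊛-comm g oneS n) (⊛-identityˡ g n)

shift-⊛ : ∀ c f g → (shift c f ⊛ g) ≈ shift c (f ⊛ g)
shift-⊛ c f g n with c ≤? n
... | no c≰n = trans (⊛-as-∑ (shift c f) g n) (∑-zero (suc n) (λ k k<1+n →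
        trans (cong (_*z g (n ∸ k)) (shift-≰ c f k (λ c≤k → c≰n (NP.≤-trans c≤k (NP.≤-pred k<1+n)))))
              (ZP.*-zeroˡ (g (n ∸ k)))))
... | yes c≤n = begin
  (shift c f ⊛ g) n                                       ≡⟨ ⊛-as-∑ (shift c f) g n ⟩
  ∑ F (suc n)                                             ≡⟨ cong (∑ F) 1+n≡ ⟩
  ∑ F (c + suc (n ∸ c))                                   ≡⟨ ∑-+ F c (suc (n ∸ c)) ⟩
  ∑ F c +z ∑ (λ j → F (c + j)) (suc (n ∸ c))
    ≡⟨ cong₂ _+z_ (∑-zero c below-c) (∑-cong (suc (n ∸ c)) above-c) ⟩
  + 0 +z ∑ (λ j → f j *z g ((n ∸ c) ∸ j)) (suc (n ∸ c))   ≡⟨ ZP.+-identityˡ _ ⟩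
  ∑ (λ j → f j *z g ((n ∸ c) ∸ j)) (suc (n ∸ c))          ≡⟨ ⊛-as-∑ f g (n ∸ c) ⟨
  (f ⊛ g) (n ∸ c)                                         ∎
  where
  open ≡-Reasoning
  F : ℕ → ℤ
  F k = shift c f k *z g (n ∸ k)
  1+n≡ : suc n ≡ c + suc (n ∸ c)
  1+n≡ = trans (cong suc (sym (NP.m+[n∸m]≡n c≤n))) (sym (NP.+-suc c (n ∸ c)))
  below-c : ∀ k → k < c → F k ≡ + 0
  below-c k k<c = trans (cong (_*z g (n ∸ k)) (shift-≰ c f k (NP.<⇒≱ k<c))) (ZP.*-zeroˡ (g (n ∸ k)))
  above-c : ∀ j → j < suc (n ∸ c) → F (c + j) ≡ f j *z g ((n ∸ c) ∸ j)
  above-c j _ = cong₂ _*z_ (trans (shift-≤ c f (c + j) (NP.m≤m+n c j)) (cong f (NP.m+n∸m≡n c j)))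
                           (cong g (sym (NP.∸-+-assoc n c j)))

⊛-shift : ∀ c f g → (f ⊛ shift c g) ≈ shift c (f ⊛ g)
⊛-shift c f g n = trans (⊛-comm f (shift c g) n) (trans (shift-⊛ c g f n) (shift-cong c (⊛-comm g f) n))

shift-⊕-shift : ∀ c d (f g h : Series) → f ≈ (g ⊕ shift d h) → shift c f ≈ (shift c g ⊕ shift (c + d) h)
shift-⊕-shift c d f g h f≈ n =
  trans (shift-cong c f≈ n) (trans (shift-⊕ c g (shift d h) n) (cong (shift c g n +z_) (shift-shift c d h n)))

-- Inverses and q-Pochhammer symbols

invRev-applyUpTo : ∀ f n → invRev f n ≡ applyUpTo (λ k → inv f (n ∸ k)) (suc n)
invRev-applyUpTo f zero    = refl
invRev-applyUpTo f (suc n) = cong (inv f (suc n) ∷_) (invRev-applyUpTo f n)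

zipWith-applyUpTo : ∀ {A B C : Set} (h : A → B → C) (a : ℕ → A) (b : ℕ → B) n →
                    zipWith h (applyUpTo a n) (applyUpTo b n) ≡ applyUpTo (λ k → h (a k) (b k)) n
zipWith-applyUpTo h a b zero    = refl
zipWith-applyUpTo h a b (suc n) = cong (h (a 0) (b 0) ∷_) (zipWith-applyUpTo h (a ∘ suc) (b ∘ suc) n)

inv-suc : ∀ f n → inv f (suc n) ≡ - ∑ (λ k → f (suc k) *z inv f (n ∸ k)) (suc n)
inv-suc f n = cong -_ (begin
  sumℤ (zipWith (λ k g → f (suc k) *z g) (upTo (suc n)) (invRev f n))
    ≡⟨ cong (sumℤ ∘ zipWith (λ k g → f (suc k) *z g) (upTo (suc n))) (invRev-applyUpTo f n) ⟩
  sumℤ (zipWith (λ k g → f (suc k) *z g) (upTo (suc n)) (applyUpTo (λ k → inv f (n ∸ k)) (suc n)))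
    ≡⟨ cong sumℤ (zipWith-applyUpTo (λ k g → f (suc k) *z g) (λ k → k) (λ k → inv f (n ∸ k)) (suc n)) ⟩
  sumℤ (applyUpTo (λ k → f (suc k) *z inv f (n ∸ k)) (suc n))
    ≡⟨ sumℤ-applyUpTo (λ k → f (suc k) *z inv f (n ∸ k)) (suc n) ⟩
  ∑ (λ k → f (suc k) *z inv f (n ∸ k)) (suc n)
    ∎)
  where open ≡-Reasoning

⊛-inverseʳ : ∀ f → f 0 ≡ + 1 → (f ⊛ inv f) ≈ oneS
⊛-inverseʳ f f₀≡1 zero    = trans (⊛-as-∑ f (inv f) 0) (cong (λ x → x *z + 1 +z + 0) f₀≡1)
⊛-inverseʳ f f₀≡1 (suc n) = begin
  (f ⊛ inv f) (suc n)          ≡⟨ ⊛-as-∑ f (inv f) (suc n) ⟩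
  f 0 *z inv f (suc n) +z S    ≡⟨ cong₂ (λ a b → a *z b +z S) f₀≡1 (inv-suc f n) ⟩
  + 1 *z - S +z S              ≡⟨ cancel S ⟩
  + 0                          ∎
  where
  open ≡-Reasoning
  S : ℤ
  S = ∑ (λ k → f (suc k) *z inv f (n ∸ k)) (suc n)
  cancel : ∀ (s : ℤ) → + 1 *z - s +z s ≡ + 0
  cancel = ℤ-Solver.solve-∀

inv-unique : ∀ f h → f 0 ≡ + 1 → (f ⊛ h) ≈ oneS → h ≈ inv f
inv-unique f h f₀≡1 fh≈1 n = agree-below n n NP.≤-refl
  where
  solve : ∀ (x s : ℤ) → + 1 *z x +z s ≡ + 0 → x ≡ - s
  solve x s e = trans (sym (lemma x s)) (trans (cong (_-z s) e) (ZP.+-identityˡ (- s)))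
    where
    lemma : ∀ (x s : ℤ) → (+ 1 *z x +z s) -z s ≡ x
    lemma = ℤ-Solver.solve-∀
  agree-below : ∀ n k → k ≤ n → h k ≡ inv f k
  agree-below zero zero _ = begin
    h 0                      ≡⟨ sym (ZP.*-identityˡ (h 0)) ⟩
    + 1 *z h 0               ≡⟨ cong (_*z h 0) (sym f₀≡1) ⟩
    f 0 *z h 0               ≡⟨ sym (⊛-at-0 f h) ⟩
    (f ⊛ h) 0                ≡⟨ fh≈1 0 ⟩
    + 1                      ∎
    where open ≡-Reasoning
  agree-below (suc n) k k≤1+n with k ≤? n
  ... | yes k≤n = agree-below n k k≤n
  ... | no k≰n with NP.≤-antisym k≤1+n (NP.≰⇒> k≰n)
  ...   | refl = begin
    h (suc n)                                          ≡⟨ solve (h (suc n)) S eqn ⟩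
    - S                                                ≡⟨ cong -_ (∑-cong (suc n) (λ j _ → cong (f (suc j) *z_)
                                                            (agree-below n (n ∸ j) (NP.m∸n≤m n j)))) ⟩
    - ∑ (λ j → f (suc j) *z inv f (n ∸ j)) (suc n)     ≡⟨ inv-suc f n ⟨
    inv f (suc n)                                      ∎
    where
    open ≡-Reasoning
    S : ℤ
    S = ∑ (λ j → f (suc j) *z h (n ∸ j)) (suc n)
    eqn : + 1 *z h (suc n) +z S ≡ + 0
    eqn = trans (cong (λ a → a *z h (suc n) +z S) (sym f₀≡1))
                (trans (sym (⊛-as-∑ f h (suc n))) (fh≈1 (suc n)))

oneMinusMono : ℕ → Series
oneMinusMono c = oneS ⊖ mono c

⊛-oneMinusMono : ∀ X c → (X ⊛ oneMinusMono c) ≈ (X ⊖ shift c X)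
⊛-oneMinusMono X c n = trans (⊛-distribˡ-⊖ X oneS (mono c) n) (cong₂ _-z_ (⊛-identityʳ X n)
  (trans (⊛-cong {X} (λ _ → refl) (mono≈shift-oneS c) n)
         (trans (⊛-shift c X oneS n) (shift-cong c (⊛-identityʳ X) n))))

⊖shift-⊛ : ∀ X c h → ((X ⊖ shift c X) ⊛ h) ≈ ((X ⊛ h) ⊖ shift c (X ⊛ h))
⊖shift-⊛ X c h n = trans (⊛-distribʳ-⊖ X (shift c X) h n) (cong ((X ⊛ h) n -z_) (shift-⊛ c X h n))

⊛-⊖shift : ∀ X c h → (X ⊛ (h ⊖ shift c h)) ≈ ((X ⊛ h) ⊖ shift c (X ⊛ h))
⊛-⊖shift X c h n = trans (⊛-distribˡ-⊖ X h (shift c h) n) (cong ((X ⊛ h) n -z_) (⊛-shift c X h n))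

inv-⊖shift : ∀ X Y c → X 0 ≡ + 1 → Y 0 ≡ + 1 → Y ≈ (X ⊖ shift c X) →
             inv Y ≈ (inv X ⊕ shift c (inv Y))
inv-⊖shift X Y c X₀≡1 Y₀≡1 Y≈ n =
  sym (trans (cong (_+z shift c h n) (sym (h⊖≈invX n))) (cancel (h n) (shift c h n)))
  where
  h : Series
  h = inv Y
  cancel : ∀ (a b : ℤ) → (a -z b) +z b ≡ a
  cancel = ℤ-Solver.solve-∀
  X⊛h⊖≈1 : (X ⊛ (h ⊖ shift c h)) ≈ oneS
  X⊛h⊖≈1 k = trans (⊛-⊖shift X c h k) (trans (sym (⊖shift-⊛ X c h k))
    (trans (⊛-cong {g = h} {g′ = h} (λ j → sym (Y≈ j)) (λ _ → refl) k) (⊛-inverseʳ Y Y₀≡1 k)))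
  h⊖≈invX : (h ⊖ shift c h) ≈ inv X
  h⊖≈invX = inv-unique X (h ⊖ shift c h) X₀≡1 X⊛h⊖≈1

qPoch-at-0 : ∀ a b n → qPoch (suc a) b n 0 ≡ + 1
qPoch-at-0 a b zero    = refl
qPoch-at-0 a b (suc n) = trans (⊛-at-0 (qPoch (suc a) b n) (oneMinusMono (suc a + b * n)))
                               (cong (_*z + 1) (qPoch-at-0 a b n))

pochhammers : ℕ → ℕ → Series
pochhammers n₁ n₂ = qPoch 1 1 n₁ ⊛ qPoch 3 3 n₂

invPochhammers : ℕ → ℕ → Series
invPochhammers n₁ n₂ = inv (pochhammers n₁ n₂)

pochhammers-at-0 : ∀ n₁ n₂ → pochhammers n₁ n₂ 0 ≡ + 1
pochhammers-at-0 n₁ n₂ = trans (⊛-at-0 (qPoch 1 1 n₁) (qPoch 3 3 n₂))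
                               (cong₂ _*z_ (qPoch-at-0 0 1 n₁) (qPoch-at-0 2 3 n₂))

invPochhammers-0-0 : invPochhammers 0 0 ≈ oneS
invPochhammers-0-0 n = sym (inv-unique (pochhammers 0 0) oneS (pochhammers-at-0 0 0)
  (λ k → trans (⊛-identityʳ (pochhammers 0 0) k) (⊛-identityˡ oneS k)) n)

invPochhammers-suc₁ : ∀ n₁ n₂ →
  invPochhammers (suc n₁) n₂ ≈ (invPochhammers n₁ n₂ ⊕ shift (suc n₁) (invPochhammers (suc n₁) n₂))
invPochhammers-suc₁ n₁ n₂ n =
  subst (λ c → invPochhammers (suc n₁) n₂ n ≡ invPochhammers n₁ n₂ n +z shift c (invPochhammers (suc n₁) n₂) n)
        (cong suc (NP.+-identityʳ n₁))
        (inv-⊖shift (pochhammers n₁ n₂) (pochhammers (suc n₁) n₂) (1 + 1 * n₁)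
                    (pochhammers-at-0 n₁ n₂) (pochhammers-at-0 (suc n₁) n₂) factor n)
  where
  factor : pochhammers (suc n₁) n₂ ≈ (pochhammers n₁ n₂ ⊖ shift (1 + 1 * n₁) (pochhammers n₁ n₂))
  factor k = trans (⊛-cong {g = qPoch 3 3 n₂} {g′ = qPoch 3 3 n₂} (⊛-oneMinusMono (qPoch 1 1 n₁) (1 + 1 * n₁)) (λ _ → refl) k)
                   (⊖shift-⊛ (qPoch 1 1 n₁) (1 + 1 * n₁) (qPoch 3 3 n₂) k)

invPochhammers-suc₂ : ∀ n₁ n₂ →
  invPochhammers n₁ (suc n₂) ≈ (invPochhammers n₁ n₂ ⊕ shift (3 * suc n₂) (invPochhammers n₁ (suc n₂)))
invPochhammers-suc₂ n₁ n₂ n =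
  subst (λ c → invPochhammers n₁ (suc n₂) n ≡ invPochhammers n₁ n₂ n +z shift c (invPochhammers n₁ (suc n₂)) n)
        (sym (NP.*-suc 3 n₂))
        (inv-⊖shift (pochhammers n₁ n₂) (pochhammers n₁ (suc n₂)) (3 + 3 * n₂)
                    (pochhammers-at-0 n₁ n₂) (pochhammers-at-0 n₁ (suc n₂)) factor n)
  where
  factor : pochhammers n₁ (suc n₂) ≈ (pochhammers n₁ n₂ ⊖ shift (3 + 3 * n₂) (pochhammers n₁ n₂))
  factor k = trans (⊛-cong {qPoch 1 1 n₁} (λ _ → refl) (⊛-oneMinusMono (qPoch 3 3 n₂) (3 + 3 * n₂)) k)
                   (⊛-⊖shift (qPoch 1 1 n₁) (3 + 3 * n₂) (qPoch 3 3 n₂) k)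

-- A q-difference system with a unique solution

shift-fixpoint-unique : ∀ c {f g r r′ : Series} → 1 ≤ c → r ≈ r′ →
                        f ≈ (shift c f ⊕ r) → g ≈ (shift c g ⊕ r′) → f ≈ g
shift-fixpoint-unique c {f} {g} {r} {r′} 1≤c r≈r′ f≈ g≈ n = agree n n NP.≤-refl
  where
  agree : ∀ N n → n ≤ N → f n ≡ g n
  agree N n n≤N = trans (f≈ n) (trans (cong₂ _+z_ (shift-cong-< c f g n 1≤c (below N n≤N)) (r≈r′ n)) (sym (g≈ n)))
    where
    below : ∀ N → n ≤ N → ∀ k → k < n → f k ≡ g k
    below zero    n≤0   k k<n = contradiction (NP.≤-trans k<n n≤0) λ ()
    below (suc N) n≤1+N k k<n = agree N k (NP.≤-pred (NP.≤-trans k<n n≤1+N))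

record QDiffSystem (u₁ u₂ u₃ : ℕ → Series) : Set where
  field
    initial₁ : u₁ 0 ≈ oneS
    initial₃ : u₃ 0 ≈ u₁ 0
    initial₂ : u₂ 0 ≈ u₃ 0
    step₃ : ∀ m → u₃ (suc m) ≈ (shift (3 * suc m) (u₁ (suc m)) ⊕ shift (3 + 6 * m) (u₁ m))
    step₂ : ∀ m → u₂ (suc m) ≈ (u₃ (suc m) ⊕ shift (2 + 3 * m) (u₂ m))
    step₁ : ∀ m → (u₁ (suc m) ⊕ shift (1 + 3 * m) (u₁ m))
                ≈ ((u₂ (suc m) ⊕ shift (1 + 3 * m) (u₂ m)) ⊕ shift 1 (u₃ m))

  lowerOrder : ℕ → Series
  lowerOrder m = ((((shift (3 + 6 * m) (u₁ m) ⊕ shift (2 + 3 * m) (u₂ m)) ⊕ shift (1 + 3 * m) (u₂ m))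
                   ⊕ shift 1 (u₃ m)) ⊖ shift (1 + 3 * m) (u₁ m))

  u₁-suc-fixpoint : ∀ m → u₁ (suc m) ≈ (shift (3 * suc m) (u₁ (suc m)) ⊕ lowerOrder m)
  u₁-suc-fixpoint m n = begin
    u₁ (suc m) n                                ≡⟨ cancel (u₁ (suc m) n) A ⟨
    (u₁ (suc m) n +z A) -z A                    ≡⟨ cong (_-z A) (step₁ m n) ⟩
    (((u₂ (suc m) n +z B) +z C) -z A)
      ≡⟨ cong (λ x → ((x +z B) +z C) -z A) (trans (step₂ m n) (cong (_+z D) (step₃ m n))) ⟩
    ((((S +z F) +z D) +z B) +z C) -z A          ≡⟨ regroup S F D B C A ⟩
    S +z ((((F +z D) +z B) +z C) -z A)          ∎
    where
    open ≡-Reasoning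
    A : ℤ
    A = shift (1 + 3 * m) (u₁ m) n
    B : ℤ
    B = shift (1 + 3 * m) (u₂ m) n
    C : ℤ
    C = shift 1 (u₃ m) n
    D : ℤ
    D = shift (2 + 3 * m) (u₂ m) n
    S : ℤ
    S = shift (3 * suc m) (u₁ (suc m)) n
    F : ℤ
    F = shift (3 + 6 * m) (u₁ m) n
    cancel : ∀ (x a : ℤ) → (x +z a) -z a ≡ x
    cancel = ℤ-Solver.solve-∀
    regroup : ∀ (S F D B C A : ℤ) → ((((S +z F) +z D) +z B) +z C) -z A ≡ S +z ((((F +z D) +z B) +z C) -z A)
    regroup = ℤ-Solver.solve-∀

module _ {u₁ u₂ u₃ v₁ v₂ v₃ : ℕ → Series} (U : QDiffSystem u₁ u₂ u₃) (V : QDiffSystem v₁ v₂ v₃) where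
  open QDiffSystem

  qDiffSystem-unique : ∀ m → u₁ m ≈ v₁ m × u₂ m ≈ v₂ m × u₃ m ≈ v₃ m
  qDiffSystem-unique zero = u₁≈v₁ , (λ n → trans (initial₂ U n) (trans (u₃≈v₃ n) (sym (initial₂ V n)))) , u₃≈v₃
    where
    u₁≈v₁ : u₁ 0 ≈ v₁ 0
    u₁≈v₁ n = trans (initial₁ U n) (sym (initial₁ V n))
    u₃≈v₃ : u₃ 0 ≈ v₃ 0
    u₃≈v₃ n = trans (initial₃ U n) (trans (u₁≈v₁ n) (sym (initial₃ V n)))
  qDiffSystem-unique (suc m) = u₁≈v₁ , u₂≈v₂ , u₃≈v₃
    where
    ih : u₁ m ≈ v₁ m × u₂ m ≈ v₂ m × u₃ m ≈ v₃ m
    ih = qDiffSystem-unique m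
    lowerOrder≈ : lowerOrder U m ≈ lowerOrder V m
    lowerOrder≈ n =
      cong₂ _-z_ (cong₂ _+z_ (cong₂ _+z_ (cong₂ _+z_ (shift-cong (3 + 6 * m) (proj₁ ih) n)
                                                     (shift-cong (2 + 3 * m) (proj₁ (proj₂ ih)) n))
                                         (shift-cong (1 + 3 * m) (proj₁ (proj₂ ih)) n))
                             (shift-cong 1 (proj₂ (proj₂ ih)) n))
                 (shift-cong (1 + 3 * m) (proj₁ ih) n)
    u₁≈v₁ : u₁ (suc m) ≈ v₁ (suc m)
    u₁≈v₁ = shift-fixpoint-unique (3 * suc m) (s≤s z≤n) lowerOrder≈ (u₁-suc-fixpoint U m) (u₁-suc-fixpoint V m)
    u₃≈v₃ : u₃ (suc m) ≈ v₃ (suc m)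
    u₃≈v₃ n = trans (step₃ U m n) (trans (cong₂ _+z_ (shift-cong (3 * suc m) u₁≈v₁ n)
                                                       (shift-cong (3 + 6 * m) (proj₁ ih) n))
                                         (sym (step₃ V m n)))
    u₂≈v₂ : u₂ (suc m) ≈ v₂ (suc m)
    u₂≈v₂ n = trans (step₂ U m n) (trans (cong₂ _+z_ (u₃≈v₃ n) (shift-cong (2 + 3 * m) (proj₁ (proj₂ ih)) n))
                                         (sym (step₂ V m n)))

-- The sum side

rhsExp-+ : ∀ n₁ n₂ → rhsExp n₁ n₂ + (2 * n₂ + n₁) ≡ 6 * n₂ * n₂ + 2 * n₁ * n₁ + 6 * n₂ * n₁
rhsExp-+ n₁ n₂ = NP.m∸n+n≡m linear≤quadratic
  where
  n≤n*n : ∀ n → n ≤ n * n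
  n≤n*n zero    = z≤n
  n≤n*n (suc n) = NP.m≤m*n (suc n) (suc n)
  regroup : ∀ n₁ n₂ → 6 * n₂ * n₂ + 2 * n₁ * n₁ + 6 * n₂ * n₁
                    ≡ (2 * (n₂ * n₂) + n₁ * n₁) + (4 * (n₂ * n₂) + n₁ * n₁ + 6 * n₂ * n₁)
  regroup = ℕ-Solver.solve-∀
  linear≤quadratic : 2 * n₂ + n₁ ≤ 6 * n₂ * n₂ + 2 * n₁ * n₁ + 6 * n₂ * n₁
  linear≤quadratic = subst (2 * n₂ + n₁ ≤_) (sym (regroup n₁ n₂))
    (NP.≤-trans (NP.+-mono-≤ (NP.*-monoʳ-≤ 2 (n≤n*n n₂)) (n≤n*n n₁)) (NP.m≤m+n _ _))

rhsExp-suc₁ : ∀ n₁ n₂ → rhsExp (suc n₁) n₂ ≡ rhsExp n₁ n₂ + (4 * n₁ + 6 * n₂ + 1)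
rhsExp-suc₁ n₁ n₂ = NP.+-cancelʳ-≡ (2 * n₂ + suc n₁) _ _ (begin
  rhsExp (suc n₁) n₂ + (2 * n₂ + suc n₁)                ≡⟨ rhsExp-+ (suc n₁) n₂ ⟩
  6 * n₂ * n₂ + 2 * suc n₁ * suc n₁ + 6 * n₂ * suc n₁   ≡⟨ expand n₁ n₂ ⟩
  (6 * n₂ * n₂ + 2 * n₁ * n₁ + 6 * n₂ * n₁) + (4 * n₁ + 6 * n₂ + 2)
                                                        ≡⟨ cong (_+ (4 * n₁ + 6 * n₂ + 2)) (rhsExp-+ n₁ n₂) ⟨
  (e + (2 * n₂ + n₁)) + (4 * n₁ + 6 * n₂ + 2)           ≡⟨ regroup n₁ n₂ e ⟩
  (e + (4 * n₁ + 6 * n₂ + 1)) + (2 * n₂ + suc n₁)       ∎)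
  where
  open ≡-Reasoning
  e : ℕ
  e = rhsExp n₁ n₂
  expand : ∀ n₁ n₂ → 6 * n₂ * n₂ + 2 * (1 + n₁) * (1 + n₁) + 6 * n₂ * (1 + n₁)
                   ≡ (6 * n₂ * n₂ + 2 * n₁ * n₁ + 6 * n₂ * n₁) + (4 * n₁ + 6 * n₂ + 2)
  expand = ℕ-Solver.solve-∀
  regroup : ∀ n₁ n₂ e → (e + (2 * n₂ + n₁)) + (4 * n₁ + 6 * n₂ + 2)
                      ≡ (e + (4 * n₁ + 6 * n₂ + 1)) + (2 * n₂ + (1 + n₁))
  regroup = ℕ-Solver.solve-∀

rhsExp-suc₂ : ∀ n₁ n₂ → rhsExp n₁ (suc n₂) ≡ rhsExp n₁ n₂ + (12 * n₂ + 6 * n₁ + 4)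
rhsExp-suc₂ n₁ n₂ = NP.+-cancelʳ-≡ (2 * suc n₂ + n₁) _ _ (begin
  rhsExp n₁ (suc n₂) + (2 * suc n₂ + n₁)                       ≡⟨ rhsExp-+ n₁ (suc n₂) ⟩
  6 * suc n₂ * suc n₂ + 2 * n₁ * n₁ + 6 * suc n₂ * n₁          ≡⟨ expand n₁ n₂ ⟩
  (6 * n₂ * n₂ + 2 * n₁ * n₁ + 6 * n₂ * n₁) + (12 * n₂ + 6 * n₁ + 6)
                                                               ≡⟨ cong (_+ (12 * n₂ + 6 * n₁ + 6)) (rhsExp-+ n₁ n₂) ⟨
  (e + (2 * n₂ + n₁)) + (12 * n₂ + 6 * n₁ + 6)                 ≡⟨ regroup n₁ n₂ e ⟩
  (e + (12 * n₂ + 6 * n₁ + 4)) + (2 * suc n₂ + n₁)             ∎)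
  where
  open ≡-Reasoning
  e : ℕ
  e = rhsExp n₁ n₂
  expand : ∀ n₁ n₂ → 6 * (1 + n₂) * (1 + n₂) + 2 * n₁ * n₁ + 6 * (1 + n₂) * n₁
                   ≡ (6 * n₂ * n₂ + 2 * n₁ * n₁ + 6 * n₂ * n₁) + (12 * n₂ + 6 * n₁ + 6)
  expand = ℕ-Solver.solve-∀
  regroup : ∀ n₁ n₂ e → (e + (2 * n₂ + n₁)) + (12 * n₂ + 6 * n₁ + 6)
                      ≡ (e + (12 * n₂ + 6 * n₁ + 4)) + (2 * (1 + n₂) + n₁)
  regroup = ℕ-Solver.solve-∀

rhsSummand : ℕ → ℕ → ℕ → ℕ → Series
rhsSummand α β n₁ n₂ = shift (rhsExp n₁ n₂ + α * n₂ + β * n₁) (invPochhammers n₁ n₂)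

rhsSummand-β-zero : ∀ α β n₂ → rhsSummand α β 0 n₂ ≈ rhsSummand α (suc β) 0 n₂
rhsSummand-β-zero α β n₂ n = cong (λ c → shift (rhsExp 0 n₂ + α * n₂ + c) (invPochhammers 0 n₂) n)
  (trans (NP.*-zeroʳ β) (sym (NP.*-zeroʳ (suc β))))

rhsSummand-α-zero : ∀ α β n₁ → rhsSummand α β n₁ 0 ≈ rhsSummand (3 + α) β n₁ 0
rhsSummand-α-zero α β n₁ n = cong (λ c → shift (rhsExp n₁ 0 + c + β * n₁) (invPochhammers n₁ 0) n)
  (trans (NP.*-zeroʳ α) (sym (NP.*-zeroʳ (3 + α))))

rhsSummand-suc₁ : ∀ α β n₁ n₂ → rhsSummand α β (suc n₁) n₂
  ≈ (rhsSummand α (suc β) (suc n₁) n₂ ⊕ shift (suc β) (rhsSummand (6 + α) (4 + β) n₁ n₂))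
rhsSummand-suc₁ α β n₁ n₂ n =
  trans (shift-⊕-shift e₀ (suc n₁) _ _ _ (invPochhammers-suc₁ n₁ n₂) n)
  (trans (cong₂ _+z_ (trans (cong (λ c → shift c (invPochhammers n₁ n₂) n) e₀≡)
                            (sym (shift-shift (suc β) e₁ (invPochhammers n₁ n₂) n)))
                     (cong (λ c → shift c (invPochhammers (suc n₁) n₂) n) (regroup₂ (rhsExp (suc n₁) n₂) α β n₁ n₂)))
         (ZP.+-comm (shift (suc β) (rhsSummand (6 + α) (4 + β) n₁ n₂) n) (rhsSummand α (suc β) (suc n₁) n₂ n)))
  where
  e₀ : ℕ
  e₀ = rhsExp (suc n₁) n₂ + α * n₂ + β * suc n₁
  e₁ : ℕ
  e₁ = rhsExp n₁ n₂ + (6 + α) * n₂ + (4 + β) * n₁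
  regroup₁ : ∀ e α β n₁ n₂ → (e + (4 * n₁ + 6 * n₂ + 1)) + α * n₂ + β * (1 + n₁)
                           ≡ (1 + β) + (e + (6 + α) * n₂ + (4 + β) * n₁)
  regroup₁ = ℕ-Solver.solve-∀
  e₀≡ : e₀ ≡ suc β + e₁
  e₀≡ = trans (cong (λ x → x + α * n₂ + β * suc n₁) (rhsExp-suc₁ n₁ n₂)) (regroup₁ (rhsExp n₁ n₂) α β n₁ n₂)
  regroup₂ : ∀ e α β n₁ n₂ → (e + α * n₂ + β * (1 + n₁)) + (1 + n₁) ≡ e + α * n₂ + (1 + β) * (1 + n₁)
  regroup₂ = ℕ-Solver.solve-∀

rhsSummand-suc₂ : ∀ α β n₁ n₂ → rhsSummand α β n₁ (suc n₂)
  ≈ (rhsSummand (3 + α) β n₁ (suc n₂) ⊕ shift (4 + α) (rhsSummand (12 + α) (6 + β) n₁ n₂))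
rhsSummand-suc₂ α β n₁ n₂ n =
  trans (shift-⊕-shift e₀ (3 * suc n₂) _ _ _ (invPochhammers-suc₂ n₁ n₂) n)
  (trans (cong₂ _+z_ (trans (cong (λ c → shift c (invPochhammers n₁ n₂) n) e₀≡)
                            (sym (shift-shift (4 + α) e₁ (invPochhammers n₁ n₂) n)))
                     (cong (λ c → shift c (invPochhammers n₁ (suc n₂)) n) (regroup₂ (rhsExp n₁ (suc n₂)) α β n₁ n₂)))
         (ZP.+-comm (shift (4 + α) (rhsSummand (12 + α) (6 + β) n₁ n₂) n) (rhsSummand (3 + α) β n₁ (suc n₂) n)))
  where
  e₀ : ℕ
  e₀ = rhsExp n₁ (suc n₂) + α * suc n₂ + β * n₁
  e₁ : ℕ
  e₁ = rhsExp n₁ n₂ + (12 + α) * n₂ + (6 + β) * n₁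
  regroup₁ : ∀ e α β n₁ n₂ → (e + (12 * n₂ + 6 * n₁ + 4)) + α * (1 + n₂) + β * n₁
                           ≡ (4 + α) + (e + (12 + α) * n₂ + (6 + β) * n₁)
  regroup₁ = ℕ-Solver.solve-∀
  e₀≡ : e₀ ≡ (4 + α) + e₁
  e₀≡ = trans (cong (λ x → x + α * suc n₂ + β * n₁) (rhsExp-suc₂ n₁ n₂)) (regroup₁ (rhsExp n₁ n₂) α β n₁ n₂)
  regroup₂ : ∀ e α β n₁ n₂ → (e + α * (1 + n₂) + β * n₁) + 3 * (1 + n₂) ≡ e + (3 + α) * (1 + n₂) + β * n₁
  regroup₂ = ℕ-Solver.solve-∀

shift-rhsSummand : ∀ c α β n₁ n₂ →
  shift (c * (2 * n₂ + n₁)) (rhsSummand α β n₁ n₂) ≈ rhsSummand (2 * c + α) (c + β) n₁ n₂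
shift-rhsSummand c α β n₁ n₂ n =
  trans (shift-shift (c * (2 * n₂ + n₁)) _ (invPochhammers n₁ n₂) n)
        (cong (λ e → shift e (invPochhammers n₁ n₂) n) (regroup (rhsExp n₁ n₂) c α β n₁ n₂))
  where
  regroup : ∀ e c α β n₁ n₂ → c * (2 * n₂ + n₁) + (e + α * n₂ + β * n₁) ≡ e + (2 * c + α) * n₂ + (c + β) * n₁
  regroup = ℕ-Solver.solve-∀

rhsFamily : ℕ → ℕ → ℕ → Series
rhsFamily α β m n = ∑ (λ k → if 2 * k ≤ᵇ m then rhsSummand α β (m ∸ 2 * k) k n else + 0) (suc m)

shift-rhsFamily-as-∑ : ∀ c α β m n → shift c (rhsFamily α β m) n
  ≡ ∑ (λ k → if 2 * k ≤ᵇ m then shift c (rhsSummand α β (m ∸ 2 * k) k) n else + 0) (suc m)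
shift-rhsFamily-as-∑ c α β m n =
  trans (shift-∑ c (λ k n → if 2 * k ≤ᵇ m then rhsSummand α β (m ∸ 2 * k) k n else + 0) (suc m) n)
        (∑-cong (suc m) (λ k _ → shift-if c (2 * k ≤ᵇ m) (rhsSummand α β (m ∸ 2 * k) k) n))

shift-rhsFamily : ∀ c α β m → shift (c * m) (rhsFamily α β m) ≈ rhsFamily (2 * c + α) (c + β) m
shift-rhsFamily c α β m n = trans (shift-rhsFamily-as-∑ (c * m) α β m n) (∑-cong (suc m) (λ k _ → termwise k))
  where
  termwise : ∀ k → (if 2 * k ≤ᵇ m then shift (c * m) (rhsSummand α β (m ∸ 2 * k) k) n else + 0)
                 ≡ (if 2 * k ≤ᵇ m then rhsSummand (2 * c + α) (c + β) (m ∸ 2 * k) k n else + 0)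
  termwise k with 2 * k ≤? m
  ... | yes 2k≤m rewrite ≤ᵇ-true 2k≤m =
    trans (cong (λ i → shift (c * i) (rhsSummand α β (m ∸ 2 * k) k) n) (sym (NP.m+[n∸m]≡n 2k≤m)))
          (shift-rhsSummand c α β (m ∸ 2 * k) k n)
  ... | no 2k≰m rewrite ≤ᵇ-false 2k≰m = refl

rhsFamily-β-zero : ∀ α β → rhsFamily α β 0 ≈ rhsFamily α (suc β) 0
rhsFamily-β-zero α β n = cong (_+z + 0) (rhsSummand-β-zero α β 0 n)

rhsFamily-α-zero : ∀ α β → rhsFamily α β 0 ≈ rhsFamily (3 + α) β 0
rhsFamily-α-zero α β n = cong (_+z + 0) (rhsSummand-α-zero α β 0 n)

rhsFamily-α-one : ∀ α β → rhsFamily α β 1 ≈ rhsFamily (3 + α) β 1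
rhsFamily-α-one α β n = cong (_+z (+ 0 +z + 0)) (rhsSummand-α-zero α β 1 n)

rhsFamily-split-β : ∀ α β m → rhsFamily α β (suc m)
  ≈ (rhsFamily α (suc β) (suc m) ⊕ shift (suc β) (rhsFamily (6 + α) (4 + β) m))
rhsFamily-split-β α β m n = begin
  rhsFamily α β (suc m) n                              ≡⟨ ∑-cong (suc (suc m)) (λ k _ → split k) ⟩
  ∑ (λ k → F k +z H k) (suc (suc m))                   ≡⟨ ∑-distrib-+ F H (suc (suc m)) ⟩
  R +z ∑ H (suc (suc m))                               ≡⟨ cong (R +z_) (∑-drop-last H (suc m) H-last) ⟩
  R +z ∑ H (suc m)                                     ≡⟨ cong (R +z_) (shift-rhsFamily-as-∑ (suc β) (6 + α) (4 + β) m n) ⟨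
  R +z shift (suc β) (rhsFamily (6 + α) (4 + β) m) n   ∎
  where
  open ≡-Reasoning
  R : ℤ
  R = rhsFamily α (suc β) (suc m) n
  F H : ℕ → ℤ
  F k = if 2 * k ≤ᵇ suc m then rhsSummand α (suc β) (suc m ∸ 2 * k) k n else + 0
  H k = if 2 * k ≤ᵇ m then shift (suc β) (rhsSummand (6 + α) (4 + β) (m ∸ 2 * k) k) n else + 0
  H-last : H (suc m) ≡ + 0
  H-last rewrite ≤ᵇ-false (2*suc≰ m) = refl
  split : ∀ k → (if 2 * k ≤ᵇ suc m then rhsSummand α β (suc m ∸ 2 * k) k n else + 0) ≡ F k +z H k
  split k with 2 * k ≤? m
  ... | yes 2k≤m rewrite ≤ᵇ-true 2k≤m | ≤ᵇ-true (NP.m≤n⇒m≤1+n 2k≤m) | NP.+-∸-assoc 1 2k≤m =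
    rhsSummand-suc₁ α β (m ∸ 2 * k) k n
  ... | no 2k≰m rewrite ≤ᵇ-false 2k≰m with 2 * k ≤? suc m
  ...   | no 2k≰1+m rewrite ≤ᵇ-false 2k≰1+m = refl
  ...   | yes 2k≤1+m rewrite ≤ᵇ-true 2k≤1+m | NP.m≤n⇒m∸n≡0 (NP.≰⇒> 2k≰m) =
    trans (rhsSummand-β-zero α β k n) (sym (ZP.+-identityʳ _))

rhsFamily-suc-suc : ∀ α β m n → rhsFamily α β (suc (suc m)) n
  ≡ rhsSummand α β (suc (suc m)) 0 n +z ∑ (λ j → if 2 * j ≤ᵇ m then rhsSummand α β (m ∸ 2 * j) (suc j) n else + 0) (suc (suc m))
rhsFamily-suc-suc α β m n = cong (rhsSummand α β (suc (suc m)) 0 n +z_) (∑-cong (suc (suc m)) (λ j _ → reindex j))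
  where
  reindex : ∀ j → (if 2 * suc j ≤ᵇ suc (suc m) then rhsSummand α β (suc (suc m) ∸ 2 * suc j) (suc j) n else + 0)
                ≡ (if 2 * j ≤ᵇ m then rhsSummand α β (m ∸ 2 * j) (suc j) n else + 0)
  reindex j = cong₂ (λ b i → if b then rhsSummand α β i (suc j) n else + 0)
    (trans (cong (_≤ᵇ suc (suc m)) (NP.*-suc 2 j))
           (trans (suc-≤ᵇ-suc (suc (2 * j)) (suc m)) (suc-≤ᵇ-suc (2 * j) m)))
    (cong (suc (suc m) ∸_) (NP.*-suc 2 j))

rhsFamily-split-α : ∀ α β m → rhsFamily α β (suc (suc m))
  ≈ (rhsFamily (3 + α) β (suc (suc m)) ⊕ shift (4 + α) (rhsFamily (12 + α) (6 + β) m))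
rhsFamily-split-α α β m n = begin
  rhsFamily α β (suc (suc m)) n
    ≡⟨ rhsFamily-suc-suc α β m n ⟩
  rhsSummand α β (suc (suc m)) 0 n +z ∑ (λ j → if 2 * j ≤ᵇ m then rhsSummand α β (m ∸ 2 * j) (suc j) n else + 0) (suc (suc m))
    ≡⟨ cong (rhsSummand α β (suc (suc m)) 0 n +z_) (∑-cong (suc (suc m)) (λ j _ → split j)) ⟩
  rhsSummand α β (suc (suc m)) 0 n +z ∑ (λ j → G j +z H j) (suc (suc m))
    ≡⟨ cong₂ _+z_ (rhsSummand-α-zero α β (suc (suc m)) n) (∑-distrib-+ G H (suc (suc m))) ⟩
  rhsSummand (3 + α) β (suc (suc m)) 0 n +z (∑ G (suc (suc m)) +z ∑ H (suc (suc m)))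
    ≡⟨ ZP.+-assoc (rhsSummand (3 + α) β (suc (suc m)) 0 n) (∑ G (suc (suc m))) (∑ H (suc (suc m))) ⟨
  (rhsSummand (3 + α) β (suc (suc m)) 0 n +z ∑ G (suc (suc m))) +z ∑ H (suc (suc m))
    ≡⟨ cong₂ _+z_ (sym (rhsFamily-suc-suc (3 + α) β m n)) (∑-drop-last H (suc m) H-last) ⟩
  rhsFamily (3 + α) β (suc (suc m)) n +z ∑ H (suc m)
    ≡⟨ cong (rhsFamily (3 + α) β (suc (suc m)) n +z_) (shift-rhsFamily-as-∑ (4 + α) (12 + α) (6 + β) m n) ⟨
  rhsFamily (3 + α) β (suc (suc m)) n +z shift (4 + α) (rhsFamily (12 + α) (6 + β) m) n
    ∎
  where
  open ≡-Reasoning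
  G H : ℕ → ℤ
  G j = if 2 * j ≤ᵇ m then rhsSummand (3 + α) β (m ∸ 2 * j) (suc j) n else + 0
  H j = if 2 * j ≤ᵇ m then shift (4 + α) (rhsSummand (12 + α) (6 + β) (m ∸ 2 * j) j) n else + 0
  H-last : H (suc m) ≡ + 0
  H-last rewrite ≤ᵇ-false (2*suc≰ m) = refl
  split : ∀ j → (if 2 * j ≤ᵇ m then rhsSummand α β (m ∸ 2 * j) (suc j) n else + 0) ≡ G j +z H j
  split j with 2 * j ≤ᵇ m
  ... | true  = rhsSummand-suc₂ α β (m ∸ 2 * j) j n
  ... | false = refl

shift-+-rhsFamily : ∀ c c′ α β m → shift (c + c′ * m) (rhsFamily α β m) ≈ shift c (rhsFamily (2 * c′ + α) (c′ + β) m)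
shift-+-rhsFamily c c′ α β m n =
  trans (sym (shift-shift c (c′ * m) (rhsFamily α β m) n)) (shift-cong c (shift-rhsFamily c′ α β m) n)

rhsFamily-qDiffSystem : QDiffSystem (rhsFamily 0 0) (rhsFamily 3 1) (rhsFamily 6 2)
rhsFamily-qDiffSystem = record
  { initial₁ = λ n → trans (cong (_+z + 0) (shift-0 (invPochhammers 0 0) n))
                           (trans (ZP.+-identityʳ _) (invPochhammers-0-0 n))
  ; initial₃ = λ n → refl
  ; initial₂ = λ n → refl
  ; step₃    = λ m n → trans (rhsFamily-split-β 6 2 m n)
                             (cong₂ _+z_ (sym (shift-rhsFamily 3 0 0 (suc m) n)) (sym (shift-+-rhsFamily 3 6 0 0 m n)))
  ; step₂    = step₂
  ; step₁    = step₁
  }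
  where
  step₂ : ∀ m → rhsFamily 3 1 (suc m) ≈ (rhsFamily 6 2 (suc m) ⊕ shift (2 + 3 * m) (rhsFamily 3 1 m))
  step₂ zero n = trans (rhsFamily-split-β 3 1 0 n) (cong₂ _+z_ (rhsFamily-α-one 3 2 n)
     (trans (shift-cong 2 (λ k → sym (rhsFamily-β-zero 9 4 k)) n) (sym (shift-+-rhsFamily 2 3 3 1 0 n))))
  step₂ (suc m) n = trans (rhsFamily-split-β 3 1 (suc m) n)
    (trans (cong (_+z shift 2 (rhsFamily 9 5 (suc m)) n) (rhsFamily-split-α 3 2 m n))
    (trans (regroup (rhsFamily 6 2 (suc (suc m)) n) _ _) (cong (rhsFamily 6 2 (suc (suc m)) n +z_)
    (sym (trans (shift-+-rhsFamily 2 3 3 1 (suc m) n)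
                (shift-⊕-shift 2 5 (rhsFamily 9 4 (suc m)) (rhsFamily 9 5 (suc m)) (rhsFamily 15 8 m)
                               (rhsFamily-split-β 9 4 m) n))))))
    where
    regroup : ∀ (a b c : ℤ) → (a +z b) +z c ≡ a +z (c +z b)
    regroup = ℤ-Solver.solve-∀
  step₁ : ∀ m → (rhsFamily 0 0 (suc m) ⊕ shift (1 + 3 * m) (rhsFamily 0 0 m))
              ≈ ((rhsFamily 3 1 (suc m) ⊕ shift (1 + 3 * m) (rhsFamily 3 1 m)) ⊕ shift 1 (rhsFamily 6 2 m))
  step₁ zero n =
    trans (cong₂ _+z_ (trans (rhsFamily-split-β 0 0 0 n)
                             (cong₂ _+z_ (rhsFamily-α-one 0 1 n) (shift-cong 1 (rhsFamily-α-zero 6 4) n)))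
                      (shift-+-rhsFamily 1 3 0 0 0 n))
          (cong₂ _+z_ (cong (rhsFamily 3 1 1 n +z_) (sym (shift-+-rhsFamily 1 3 3 1 0 n)))
                      (shift-cong 1 (λ k → sym (rhsFamily-β-zero 6 2 k)) n))
  step₁ (suc zero) n =
    trans (cong₂ _+z_ (trans (rhsFamily-split-β 0 0 1 n)
                             (cong₂ _+z_ (rhsFamily-split-α 0 1 0 n) (shift-cong 1 (rhsFamily-α-one 6 4) n)))
                      (shift-+-rhsFamily 1 3 0 0 1 n))
    (trans (regroup (rhsFamily 3 1 2 n) (shift 4 (rhsFamily 12 7 0) n) (shift 1 (rhsFamily 9 4 1) n)
                    (shift 1 (rhsFamily 6 3 1) n))
    (cong₂ _+z_ (cong (rhsFamily 3 1 2 n +z_) (sym (shift-+-rhsFamily 1 3 3 1 1 n)))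
       (sym (trans (shift-⊕-shift 1 3 (rhsFamily 6 2 1) (rhsFamily 6 3 1) (rhsFamily 12 6 0) (rhsFamily-split-β 6 2 0) n)
                   (cong (shift 1 (rhsFamily 6 3 1) n +z_) (shift-cong 4 (rhsFamily-β-zero 12 6) n))))))
    where
    regroup : ∀ (a b c d : ℤ) → ((a +z b) +z c) +z d ≡ (a +z c) +z (d +z b)
    regroup = ℤ-Solver.solve-∀
  step₁ (suc (suc k)) n =
    trans (cong₂ _+z_ (trans (rhsFamily-split-β 0 0 (suc (suc k)) n)
                             (cong₂ _+z_ (rhsFamily-split-α 0 1 (suc k) n)
                                         (shift-⊕-shift 1 10 (rhsFamily 6 4 (suc (suc k))) (rhsFamily 9 4 (suc (suc k)))
                                                        (rhsFamily 18 10 k) (rhsFamily-split-α 6 4 k) n)))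
                      (shift-+-rhsFamily 1 3 0 0 (suc (suc k)) n))
    (trans (regroup (rhsFamily 3 1 (suc (suc (suc k))) n) (shift 4 (rhsFamily 12 7 (suc k)) n)
                    (shift 1 (rhsFamily 9 4 (suc (suc k))) n) (shift 11 (rhsFamily 18 10 k) n)
                    (shift 1 (rhsFamily 6 3 (suc (suc k))) n))
    (cong₂ _+z_ (cong (rhsFamily 3 1 (suc (suc (suc k))) n +z_) (sym (shift-+-rhsFamily 1 3 3 1 (suc (suc k)) n)))
       (sym (trans (shift-⊕-shift 1 3 (rhsFamily 6 2 (suc (suc k))) (rhsFamily 6 3 (suc (suc k))) (rhsFamily 12 6 (suc k))
                                  (rhsFamily-split-β 6 2 (suc k)) n)
                   (cong (shift 1 (rhsFamily 6 3 (suc (suc k))) n +z_)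
                         (shift-⊕-shift 4 7 (rhsFamily 12 6 (suc k)) (rhsFamily 12 7 (suc k)) (rhsFamily 18 10 k)
                                        (rhsFamily-split-β 12 6 k) n))))))
    where
    regroup : ∀ (a b c d e : ℤ) → ((a +z b) +z (c +z d)) +z e ≡ (a +z c) +z (e +z (b +z d))
    regroup = ℤ-Solver.solve-∀

sumS-map-filter : ∀ {A : Set} {ℓ : Level} {P : Pred A ℓ} (P? : Decidable P) (g : A → Series) xs n →
  sumS (map g (filter P? xs)) n ≡ sumℤ (map (λ x → if does (P? x) then g x n else + 0) xs)
sumS-map-filter P? g []       n = refl
sumS-map-filter P? g (x ∷ xs) n with does (P? x)
... | true  = cong (g x n +z_) (sumS-map-filter P? g xs n)
... | false = trans (sumS-map-filter P? g xs n) (sym (ZP.+-identityˡ _))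

sumℤ-++ : ∀ xs ys → sumℤ (xs ++ ys) ≡ sumℤ xs +z sumℤ ys
sumℤ-++ []       ys = sym (ZP.+-identityˡ _)
sumℤ-++ (x ∷ xs) ys = trans (cong (x +z_) (sumℤ-++ xs ys)) (sym (ZP.+-assoc x _ _))

sumℤ-map-concatMap : ∀ {A B : Set} (φ : B → ℤ) (F : A → List B) xs →
  sumℤ (map φ (concatMap F xs)) ≡ sumℤ (map (λ x → sumℤ (map φ (F x))) xs)
sumℤ-map-concatMap φ F []       = refl
sumℤ-map-concatMap φ F (x ∷ xs) =
  trans (cong sumℤ (LP.map-++ φ (F x) (concatMap F xs)))
        (trans (sumℤ-++ (map φ (F x)) (map φ (concatMap F xs)))
               (cong (sumℤ (map φ (F x)) +z_) (sumℤ-map-concatMap φ F xs)))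

rhsTerm≈rhsSummand : ∀ n₁ n₂ → rhsTerm n₁ n₂ ≈ rhsSummand 0 0 n₁ n₂
rhsTerm≈rhsSummand n₁ n₂ n =
  trans (⊛-cong {g = invPochhammers n₁ n₂} {g′ = invPochhammers n₁ n₂} (mono≈shift-oneS e) (λ _ → refl) n)
  (trans (shift-⊛ e oneS (invPochhammers n₁ n₂) n)
  (trans (shift-cong e (⊛-identityˡ (invPochhammers n₁ n₂)) n)
         (cong (λ c → shift c (invPochhammers n₁ n₂) n) (sym (trans (NP.+-identityʳ (e + 0)) (NP.+-identityʳ e))))))
  where
  e : ℕ
  e = rhsExp n₁ n₂

∑-if-2*n₂+n₁≡m : ∀ m n₂ (X : ℕ → ℤ) →
  ∑ (λ n₁ → if does (2 * n₂ + n₁ ℕ.≟ m) then X n₁ else + 0) (suc m) ≡ (if 2 * n₂ ≤ᵇ m then X (m ∸ 2 * n₂) else + 0)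
∑-if-2*n₂+n₁≡m m n₂ X with 2 * n₂ ≤? m
... | yes 2n₂≤m rewrite ≤ᵇ-true 2n₂≤m =
  trans (∑-single (suc m) (m ∸ 2 * n₂) (s≤s (NP.m∸n≤m m (2 * n₂))) others)
        (cong (λ b → if b then X (m ∸ 2 * n₂) else + 0) (dec-true (2 * n₂ + (m ∸ 2 * n₂) ℕ.≟ m) (NP.m+[n∸m]≡n 2n₂≤m)))
  where
  others : ∀ k → k < suc m → k ≢ m ∸ 2 * n₂ → (if does (2 * n₂ + k ℕ.≟ m) then X k else + 0) ≡ + 0
  others k _ k≢ = cong (λ b → if b then X k else + 0) (dec-false (2 * n₂ + k ℕ.≟ m)
    (λ 2n₂+k≡m → k≢ (trans (sym (NP.m+n∸m≡n (2 * n₂) k)) (cong (_∸ 2 * n₂) 2n₂+k≡m))))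
... | no 2n₂≰m rewrite ≤ᵇ-false 2n₂≰m = ∑-zero (suc m) none
  where
  none : ∀ k → k < suc m → (if does (2 * n₂ + k ℕ.≟ m) then X k else + 0) ≡ + 0
  none k _ = cong (λ b → if b then X k else + 0) (dec-false (2 * n₂ + k ℕ.≟ m)
    (λ 2n₂+k≡m → 2n₂≰m (subst (2 * n₂ ≤_) 2n₂+k≡m (NP.m≤m+n (2 * n₂) k))))

rhsCoeffX≈rhsFamily : ∀ m → rhsCoeffX m ≈ rhsFamily 0 0 m
rhsCoeffX≈rhsFamily m n = begin
  rhsCoeffX m n
    ≡⟨ sumS-map-filter solution? (λ p → rhsTerm (proj₁ p) (proj₂ p)) grid n ⟩
  sumℤ (map φ grid)
    ≡⟨ sumℤ-map-concatMap φ (λ n₁ → map (n₁ ,_) (upTo (suc m))) (upTo (suc m)) ⟩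
  sumℤ (map (λ n₁ → sumℤ (map φ (map (n₁ ,_) (upTo (suc m))))) (upTo (suc m)))
    ≡⟨ sumℤ-map-upTo (λ n₁ → sumℤ (map φ (map (n₁ ,_) (upTo (suc m))))) (suc m) ⟩
  ∑ (λ n₁ → sumℤ (map φ (map (n₁ ,_) (upTo (suc m))))) (suc m)
    ≡⟨ ∑-cong {λ n₁ → sumℤ (map φ (map (n₁ ,_) (upTo (suc m))))} (suc m)
              (λ n₁ _ → trans (cong sumℤ (sym (LP.map-∘ {g = φ} {f = n₁ ,_} (upTo (suc m)))))
                                      (sumℤ-map-upTo (λ n₂ → Φ n₁ n₂) (suc m))) ⟩
  ∑ (λ n₁ → ∑ (Φ n₁) (suc m)) (suc m)
    ≡⟨ ∑-swap Φ (suc m) (suc m) ⟩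
  ∑ (λ n₂ → ∑ (λ n₁ → Φ n₁ n₂) (suc m)) (suc m)
    ≡⟨ ∑-cong (suc m) (λ n₂ _ → trans (∑-if-2*n₂+n₁≡m m n₂ (λ n₁ → rhsTerm n₁ n₂ n))
         (cong (λ x → if 2 * n₂ ≤ᵇ m then x else + 0) (rhsTerm≈rhsSummand (m ∸ 2 * n₂) n₂ n))) ⟩
  rhsFamily 0 0 m n
    ∎
  where
  open ≡-Reasoning
  solution? : ∀ (p : ℕ × ℕ) → Dec (2 * proj₂ p + proj₁ p ≡ m)
  solution? p = 2 * proj₂ p + proj₁ p ℕ.≟ m
  grid : List (ℕ × ℕ)
  grid = concatMap (λ n₁ → map (n₁ ,_) (upTo (suc m))) (upTo (suc m))
  φ : ℕ × ℕ → ℤ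
  φ p = if does (solution? p) then rhsTerm (proj₁ p) (proj₂ p) n else + 0
  Φ : ℕ → ℕ → ℤ
  Φ n₁ n₂ = φ (n₁ , n₂)

-- The partition side

gapOKᵇ : ℕ → ℕ → Bool
gapOKᵇ a b = does (gapOK? a b)

chainCount : (ℕ → Bool) → ℕ → Series
chainCount P zero    zero    = + 1
chainCount P zero    (suc _) = + 0
chainCount P (suc m) n       = ∑ (λ a → if P (suc a) then chainCount (gapOKᵇ (suc a)) m (n ∸ suc a) else + 0) n

indicator : Bool → ℤ
indicator b = if b then + 1 else + 0

countℤ : {A : Set} → (A → Bool) → List A → ℤ
countℤ φ xs = sumℤ (map (indicator ∘ φ) xs)

length-filter : ∀ {A : Set} {P : A → Set} (P? : ∀ x → Dec (P x)) xs → + length (filter P? xs) ≡ countℤ (does ∘ P?) xs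
length-filter P? []       = refl
length-filter P? (x ∷ xs) with does (P? x)
... | true  = cong (+ 1 +z_) (length-filter P? xs)
... | false = trans (length-filter P? xs) (sym (ZP.+-identityˡ _))

countℤ-cong : ∀ {A : Set} {φ ψ : A → Bool} xs → (∀ x → φ x ≡ ψ x) → countℤ φ xs ≡ countℤ ψ xs
countℤ-cong []       φ≡ψ = refl
countℤ-cong (x ∷ xs) φ≡ψ = cong₂ _+z_ (cong indicator (φ≡ψ x)) (countℤ-cong xs φ≡ψ)

countℤ-zero : ∀ {A : Set} {φ : A → Bool} xs → (∀ x → φ x ≡ false) → countℤ φ xs ≡ + 0
countℤ-zero []       φ≡false = refl
countℤ-zero (x ∷ xs) φ≡false = cong₂ _+z_ (cong indicator (φ≡false x)) (countℤ-zero xs φ≡false)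

gapChainᵇ : (ℕ → Bool) → List ℕ → Bool
gapChainᵇ P []      = true
gapChainᵇ P (b ∷ l) = P b ∧ gapChainᵇ (gapOKᵇ b) l

does-chain?-∷ : ∀ a l → does (chain? (a ∷ l)) ≡ gapChainᵇ (gapOKᵇ a) l
does-chain?-∷ a []      = refl
does-chain?-∷ a (b ∷ l) = trans
  (does-⇔ (mk⇔ (λ { (p ∷ c) → p , c }) (λ { (p , c) → p ∷ c })) (chain? (a ∷ b ∷ l)) (gapOK? a b ×-dec chain? (b ∷ l)))
  (cong (gapOKᵇ a b ∧_) (does-chain?-∷ b l))

validFromᵇ : ℕ → (ℕ → Bool) → List ℕ → Bool
validFromᵇ n P l = does (sumℕ l ℕ.≟ n) ∧ gapChainᵇ P l

does-valid? : ∀ n l → does (valid? n l) ≡ validFromᵇ n (λ _ → true) l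
does-valid? n []      = refl
does-valid? n (a ∷ l) = cong (does (sumℕ (a ∷ l) ℕ.≟ n) ∧_) (does-chain?-∷ a l)

countℤ-boxLists-suc : ∀ (ψ : List ℕ → Bool) m N →
  countℤ ψ (boxLists (suc m) N) ≡ ∑ (λ a → countℤ (λ l → ψ (suc a ∷ l)) (boxLists m N)) N
countℤ-boxLists-suc ψ m N = begin
  countℤ ψ (boxLists (suc m) N)
    ≡⟨ sumℤ-map-concatMap (indicator ∘ ψ) (λ a → map (a ∷_) (boxLists m N)) (map suc (upTo N)) ⟩
  sumℤ (map (λ a → sumℤ (map (indicator ∘ ψ) (map (a ∷_) (boxLists m N)))) (map suc (upTo N)))
    ≡⟨ cong sumℤ (LP.map-∘ {g = λ a → sumℤ (map (indicator ∘ ψ) (map (a ∷_) (boxLists m N)))} {f = suc} (upTo N)) ⟨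
  sumℤ (map (λ a → sumℤ (map (indicator ∘ ψ) (map (suc a ∷_) (boxLists m N)))) (upTo N))
    ≡⟨ sumℤ-map-upTo _ N ⟩
  ∑ (λ a → sumℤ (map (indicator ∘ ψ) (map (suc a ∷_) (boxLists m N)))) N
    ≡⟨ ∑-cong N (λ a _ → cong sumℤ (LP.map-∘ {g = indicator ∘ ψ} {f = suc a ∷_} (boxLists m N))) ⟨
  ∑ (λ a → countℤ (λ l → ψ (suc a ∷ l)) (boxLists m N)) N
    ∎
  where open ≡-Reasoning

countℤ-boxLists≡chainCount : ∀ m N n P → n ≤ N → countℤ (validFromᵇ n P) (boxLists m N) ≡ chainCount P m n
countℤ-boxLists≡chainCount zero    N zero    P _   = refl
countℤ-boxLists≡chainCount zero    N (suc n) P _   = refl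
countℤ-boxLists≡chainCount (suc m) N n       P n≤N =
  trans (countℤ-boxLists-suc (validFromᵇ n P) m N)
        (trans (∑-truncate B n N n≤N (λ a n≤a _ → too-large a n≤a)) (∑-cong n first-part))
  where
  B : ℕ → ℤ
  B a = countℤ (λ l → validFromᵇ n P (suc a ∷ l)) (boxLists m N)
  too-large : ∀ a → n ≤ a → B a ≡ + 0
  too-large a n≤a = countℤ-zero (boxLists m N) (λ l → cong (_∧ (P (suc a) ∧ gapChainᵇ (gapOKᵇ (suc a)) l))
    (dec-false (sumℕ (suc a ∷ l) ℕ.≟ n)
               (λ sum≡n → NP.<⇒≱ (s≤s n≤a) (subst (suc a ≤_) sum≡n (NP.m≤m+n (suc a) (sumℕ l))))))
  first-part : ∀ a → a < n → B a ≡ (if P (suc a) then chainCount (gapOKᵇ (suc a)) m (n ∸ suc a) else + 0)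
  first-part a a<n with P (suc a)
  ... | false = countℤ-zero (boxLists m N) (λ l → BP.∧-zeroʳ _)
  ... | true  = trans (countℤ-cong (boxLists m N) (λ l → cong (_∧ gapChainᵇ (gapOKᵇ (suc a)) l)
                  (does-⇔ (mk⇔ (λ e → trans (sym (NP.m+n∸m≡n (suc a) (sumℕ l))) (cong (_∸ suc a) e))
                                (λ e → trans (cong (λ x → suc a + x) e) (NP.m+[n∸m]≡n a<n)))
                          (sumℕ (suc a ∷ l) ℕ.≟ n) (sumℕ l ℕ.≟ n ∸ suc a))))
                      (countℤ-boxLists≡chainCount m N (n ∸ suc a) (gapOKᵇ (suc a)) (NP.≤-trans (NP.m∸n≤m n (suc a)) n≤N))

lhsCoeffX≡chainCount : ∀ m n → lhsCoeffX m n ≡ chainCount (λ _ → true) m n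
lhsCoeffX≡chainCount m n = begin
  + cp11 n m                                                ≡⟨ length-filter (valid? n) (boxLists m n) ⟩
  countℤ (does ∘ valid? n) (boxLists m n)                   ≡⟨ countℤ-cong (boxLists m n) (does-valid? n) ⟩
  countℤ (validFromᵇ n (λ _ → true)) (boxLists m n)         ≡⟨ countℤ-boxLists≡chainCount m n n (λ _ → true) NP.≤-refl ⟩
  chainCount (λ _ → true) m n                               ∎
  where open ≡-Reasoning

gapOKᵇ-+3 : ∀ b c → gapOKᵇ (3 + b) (3 + c) ≡ gapOKᵇ b c
gapOKᵇ-+3 b c = does-⇔ (mk⇔ to from) (gapOK? (3 + b) (3 + c)) (gapOK? b c)
  where
  sum%3 : ((3 + b) + (3 + c)) % 3 ≡ (b + c) % 3
  sum%3 = trans (cong (_% 3) (regroup b c)) ([m+kn]%n≡m%n (b + c) 2 3)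
    where
    regroup : ∀ b c → (3 + b) + (3 + c) ≡ (b + c) + 2 * 3
    regroup = ℕ-Solver.solve-∀
  to : GapOK (3 + b) (3 + c) → GapOK b c
  to (s≤s (s≤s (s≤s p)) , inj₁ (s≤s (s≤s (s≤s q)))) = p , inj₁ q
  to (s≤s (s≤s (s≤s p)) , inj₂ q)                   = p , inj₂ (trans (sym sum%3) q)
  from : GapOK b c → GapOK (3 + b) (3 + c)
  from (p , inj₁ q) = s≤s (s≤s (s≤s p)) , inj₁ (s≤s (s≤s (s≤s q)))
  from (p , inj₂ q) = s≤s (s≤s (s≤s p)) , inj₂ (trans sum%3 q)

gapOKᵇ-small : ∀ b c → c ≤ 3 → gapOKᵇ (3 + b) c ≡ false
gapOKᵇ-small b c c≤3 = dec-false (gapOK? (3 + b) c) (λ (gap , _) → b+2≰0 (NP.≤-trans gap c≤3))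
  where
  b+2≰0 : ¬ 3 + b + 2 ≤ 3
  b+2≰0 (s≤s (s≤s (s≤s b+2≤0))) with subst (_≤ 0) (NP.+-comm b 2) b+2≤0
  ... | ()

chainCount-cong : ∀ {P Q} m → (∀ b → P b ≡ Q b) → chainCount P m ≈ chainCount Q m
chainCount-cong zero    P≡Q zero    = refl
chainCount-cong zero    P≡Q (suc n) = refl
chainCount-cong (suc m) P≡Q n       =
  ∑-cong n (λ a _ → cong (λ b → if b then chainCount (gapOKᵇ (suc a)) m (n ∸ suc a) else + 0) (P≡Q (suc a)))

∑-if-shift : ∀ k (H : ℕ → Series) (cond : ℕ → Bool) N →
  ∑ (λ a → if cond a then shift k (H a) (N ∸ suc a) else + 0) N
  ≡ shift k (λ x → ∑ (λ a → if cond a then H a (x ∸ suc a) else + 0) x) N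
∑-if-shift k H cond N with k ≤? N
... | no k≰N = ∑-zero N (λ a _ → vanishes a)
  where
  vanishes : ∀ a → (if cond a then shift k (H a) (N ∸ suc a) else + 0) ≡ + 0
  vanishes a with cond a
  ... | false = refl
  ... | true  = shift-≰ k (H a) (N ∸ suc a) (λ k≤ → k≰N (NP.≤-trans k≤ (NP.m∸n≤m N (suc a))))
... | yes k≤N = trans (∑-truncate _ (N ∸ k) N (NP.m∸n≤m N k) vanishes) (∑-cong (N ∸ k) (λ a a< → inside a a<))
  where
  vanishes : ∀ a → N ∸ k ≤ a → a < N → (if cond a then shift k (H a) (N ∸ suc a) else + 0) ≡ + 0
  vanishes a N∸k≤a a<N with cond a
  ... | false = refl
  ... | true  = shift-≰ k (H a) (N ∸ suc a) (λ k≤ → NP.<⇒≱ (s≤s N∸k≤a)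
                  (NP.m+n≤o⇒m≤o∸n (suc a) (subst (_≤ N) (NP.+-comm k (suc a)) (NP.m≤o∸n⇒m+n≤o k a<N k≤))))
  inside : ∀ a → a < N ∸ k → (if cond a then shift k (H a) (N ∸ suc a) else + 0)
                            ≡ (if cond a then H a ((N ∸ k) ∸ suc a) else + 0)
  inside a a< with cond a
  ... | false = refl
  ... | true  = trans (shift-≤ k (H a) (N ∸ suc a)
                  (NP.m+n≤o⇒m≤o∸n k (subst (_≤ N) (NP.+-comm (suc a) k) (NP.m≤o∸n⇒m+n≤o (suc a) k≤N a<))))
                (cong (H a) (trans (NP.∸-+-assoc N (suc a) k)
                  (trans (cong (N ∸_) (NP.+-comm (suc a) k)) (sym (NP.∸-+-assoc N k (suc a))))))

-- Lower every part by 3; since Q rules out first parts 1, 2, 3 this is a bijection.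
chainCount-lower3 : ∀ m (P Q : ℕ → Bool) → (∀ b → Q (3 + b) ≡ P b) → Q 1 ≡ false → Q 2 ≡ false → Q 3 ≡ false →
                    chainCount Q m ≈ shift (3 * m) (chainCount P m)
chainCount-lower3 zero P Q Q≡P Q₁ Q₂ Q₃ n = trans (empty n) (sym (shift-0 (chainCount P 0) n))
  where
  empty : chainCount Q 0 ≈ chainCount P 0
  empty zero    = refl
  empty (suc n) = refl
chainCount-lower3 (suc m) P Q Q≡P Q₁ Q₂ Q₃ zero =
  sym (shift-≰ (3 * suc m) (chainCount P (suc m)) 0 (3*suc≰ m 0 (s≤s z≤n)))
chainCount-lower3 (suc m) P Q Q≡P Q₁ Q₂ Q₃ (suc zero) rewrite Q₁ =
  sym (shift-≰ (3 * suc m) (chainCount P (suc m)) 1 (3*suc≰ m 1 (s≤s (s≤s z≤n))))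
chainCount-lower3 (suc m) P Q Q≡P Q₁ Q₂ Q₃ (suc (suc zero)) rewrite Q₁ | Q₂ =
  sym (shift-≰ (3 * suc m) (chainCount P (suc m)) 2 (3*suc≰ m 2 NP.≤-refl))
chainCount-lower3 (suc m) P Q Q≡P Q₁ Q₂ Q₃ (suc (suc (suc n))) rewrite Q₁ | Q₂ | Q₃ =
  trans (ZP.+-identityˡ _) (trans (ZP.+-identityˡ _) (trans (ZP.+-identityˡ _)
  (trans (∑-cong n (λ a _ → lower a))
  (trans (∑-if-shift (3 * m) (λ a → chainCount (gapOKᵇ (suc a)) m) (λ a → P (suc a)) n)
         (sym (trans (cong (λ c → shift c (chainCount P (suc m)) (3 + n)) (NP.*-suc 3 m))
                     (shift-+-index 3 (3 * m) (chainCount P (suc m)) n)))))))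
  where
  lower : ∀ a → (if Q (3 + suc a) then chainCount (gapOKᵇ (3 + suc a)) m (n ∸ suc a) else + 0)
              ≡ (if P (suc a) then shift (3 * m) (chainCount (gapOKᵇ (suc a)) m) (n ∸ suc a) else + 0)
  lower a rewrite Q≡P (suc a) with P (suc a)
  ... | false = refl
  ... | true  = chainCount-lower3 m (gapOKᵇ (suc a)) (gapOKᵇ (3 + suc a)) (gapOKᵇ-+3 (suc a))
                  (gapOKᵇ-small (suc a) 1 (s≤s z≤n)) (gapOKᵇ-small (suc a) 2 (s≤s (s≤s z≤n)))
                  (gapOKᵇ-small (suc a) 3 NP.≤-refl) (n ∸ suc a)

if-+-if : ∀ p q r (x : ℤ) → indicator p +z indicator q ≡ indicator r →
          (if p then x else + 0) +z (if q then x else + 0) ≡ (if r then x else + 0)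
if-+-if true  true  true  x ()
if-+-if true  true  false x ()
if-+-if true  false true  x _ = ZP.+-identityʳ x
if-+-if false true  true  x _ = ZP.+-identityˡ x
if-+-if false false false x _ = refl
if-+-if true  false false x ()
if-+-if false true  false x ()
if-+-if false false true  x ()

chainCount-+ : ∀ P Q R m → (∀ b → indicator (P b) +z indicator (Q b) ≡ indicator (R b)) →
               (chainCount P (suc m) ⊕ chainCount Q (suc m)) ≈ chainCount R (suc m)
chainCount-+ P Q R m PQ≡R n = trans (sym (∑-distrib-+ _ _ n)) (∑-cong n (λ a _ →
  if-+-if (P (suc a)) (Q (suc a)) (R (suc a)) (chainCount (gapOKᵇ (suc a)) m (n ∸ suc a)) (PQ≡R (suc a))))

chainCount-≡ᵇ : ∀ r m → chainCount (suc r ≡ᵇ_) (suc m) ≈ shift (suc r) (chainCount (gapOKᵇ (suc r)) m)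
chainCount-≡ᵇ r m n with suc r ≤? n
... | yes r<n = trans (∑-single n r r<n (λ k _ k≢r → cong (λ b → if b then f k else + 0) (dec-false (r ℕ.≟ k) (k≢r ∘ sym))))
                      (cong (λ b → if b then f r else + 0) (dec-true (r ℕ.≟ r) refl))
  where
  f : ℕ → ℤ
  f a = chainCount (gapOKᵇ (suc a)) m (n ∸ suc a)
... | no r≮n = ∑-zero n (λ k k<n → cong (λ b → if b then chainCount (gapOKᵇ (suc k)) m (n ∸ suc k) else + 0)
                 (dec-false (r ℕ.≟ k) (λ r≡k → r≮n (subst (_< n) (sym r≡k) k<n))))

split-≤ᵇ : ∀ r b → indicator (r ≡ᵇ b) +z indicator (suc r ≤ᵇ b) ≡ indicator (r ≤ᵇ b)
split-≤ᵇ zero    zero    = refl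
split-≤ᵇ zero    (suc b) = refl
split-≤ᵇ (suc r) zero    = refl
split-≤ᵇ (suc r) (suc b) rewrite suc-≤ᵇ-suc (suc r) b | suc-≤ᵇ-suc r b = split-≤ᵇ r b

gapOKᵇ-1 : ∀ b → indicator (3 ≡ᵇ b) +z indicator (5 ≤ᵇ b) ≡ indicator (gapOKᵇ 1 b)
gapOKᵇ-1 0 = refl
gapOKᵇ-1 1 = refl
gapOKᵇ-1 2 = refl
gapOKᵇ-1 3 = refl
gapOKᵇ-1 4 = refl
gapOKᵇ-1 (suc (suc (suc (suc (suc k))))) =
  cong indicator (sym (dec-true (gapOK? 1 (5 + k)) (s≤s (s≤s (s≤s z≤n)) , inj₁ (s≤s (s≤s (s≤s (s≤s (s≤s z≤n))))))))

gapOKᵇ-2 : ∀ b → gapOKᵇ 2 b ≡ (5 ≤ᵇ b)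
gapOKᵇ-2 0 = refl
gapOKᵇ-2 1 = refl
gapOKᵇ-2 2 = refl
gapOKᵇ-2 3 = refl
gapOKᵇ-2 4 = refl
gapOKᵇ-2 5 = refl
gapOKᵇ-2 (suc (suc (suc (suc (suc (suc k)))))) =
  dec-true (gapOK? 2 (6 + k)) (s≤s (s≤s (s≤s (s≤s z≤n))) , inj₁ (s≤s (s≤s (s≤s (s≤s (s≤s (s≤s z≤n)))))))

gapOKᵇ-3 : ∀ b → gapOKᵇ 3 b ≡ (7 ≤ᵇ b)
gapOKᵇ-3 0 = refl
gapOKᵇ-3 1 = refl
gapOKᵇ-3 2 = refl
gapOKᵇ-3 3 = refl
gapOKᵇ-3 4 = refl
gapOKᵇ-3 5 = refl
gapOKᵇ-3 6 = refl
gapOKᵇ-3 (suc (suc (suc (suc (suc (suc (suc k))))))) =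
  dec-true (gapOK? 3 (7 + k)) (s≤s (s≤s (s≤s (s≤s (s≤s z≤n)))) ,
                               inj₁ (s≤s (s≤s (s≤s (s≤s (s≤s (s≤s (s≤s z≤n))))))))

lhsFamily : ℕ → ℕ → Series
lhsFamily r = chainCount (r ≤ᵇ_)

lhsFamily-+3 : ∀ r m → lhsFamily (4 + r) m ≈ shift (3 * m) (lhsFamily (suc r) m)
lhsFamily-+3 r m = chainCount-lower3 m (suc r ≤ᵇ_) (4 + r ≤ᵇ_) (λ b → refl) refl refl refl

chainCount-true≈lhsFamily-1 : ∀ m → chainCount (λ _ → true) m ≈ lhsFamily 1 m
chainCount-true≈lhsFamily-1 zero    zero    = refl
chainCount-true≈lhsFamily-1 zero    (suc n) = refl
chainCount-true≈lhsFamily-1 (suc m) n       = refl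

lhsFamily-qDiffSystem : QDiffSystem (lhsFamily 1) (lhsFamily 2) (lhsFamily 3)
lhsFamily-qDiffSystem = record
  { initial₁ = λ { zero → refl ; (suc n) → refl }
  ; initial₃ = λ { zero → refl ; (suc n) → refl }
  ; initial₂ = λ { zero → refl ; (suc n) → refl }
  ; step₃    = step₃
  ; step₂    = step₂
  ; step₁    = step₁
  }
  where
  step₃ : ∀ m → lhsFamily 3 (suc m) ≈ (shift (3 * suc m) (lhsFamily 1 (suc m)) ⊕ shift (3 + 6 * m) (lhsFamily 1 m))
  step₃ m n = begin
    lhsFamily 3 (suc m) n
      ≡⟨ chainCount-+ (3 ≡ᵇ_) (4 ≤ᵇ_) (3 ≤ᵇ_) m (split-≤ᵇ 3) n ⟨
    chainCount (3 ≡ᵇ_) (suc m) n +z lhsFamily 4 (suc m) n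
      ≡⟨ cong₂ _+z_ (chainCount-≡ᵇ 2 m n) (lhsFamily-+3 0 (suc m) n) ⟩
    shift 3 (chainCount (gapOKᵇ 3) m) n +z shift (3 * suc m) (lhsFamily 1 (suc m)) n
      ≡⟨ cong (_+z shift (3 * suc m) (lhsFamily 1 (suc m)) n) (shift-cong 3 (λ k →
           trans (chainCount-cong m gapOKᵇ-3 k) (trans (lhsFamily-+3 3 m k) (shift-cong (3 * m) (lhsFamily-+3 0 m) k))) n) ⟩
    shift 3 (shift (3 * m) (shift (3 * m) (lhsFamily 1 m))) n +z shift (3 * suc m) (lhsFamily 1 (suc m)) n
      ≡⟨ cong (_+z shift (3 * suc m) (lhsFamily 1 (suc m)) n)
              (trans (shift-cong 3 (shift-shift (3 * m) (3 * m) (lhsFamily 1 m)) n)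
                     (trans (shift-shift 3 (3 * m + 3 * m) (lhsFamily 1 m) n)
                            (cong (λ c → shift (3 + c) (lhsFamily 1 m) n) (3m+3m≡6m m)))) ⟩
    shift (3 + 6 * m) (lhsFamily 1 m) n +z shift (3 * suc m) (lhsFamily 1 (suc m)) n
      ≡⟨ ZP.+-comm (shift (3 + 6 * m) (lhsFamily 1 m) n) (shift (3 * suc m) (lhsFamily 1 (suc m)) n) ⟩
    shift (3 * suc m) (lhsFamily 1 (suc m)) n +z shift (3 + 6 * m) (lhsFamily 1 m) n
      ∎
    where
    open ≡-Reasoning
    3m+3m≡6m : ∀ m → 3 * m + 3 * m ≡ 6 * m
    3m+3m≡6m = ℕ-Solver.solve-∀
  step₂ : ∀ m → lhsFamily 2 (suc m) ≈ (lhsFamily 3 (suc m) ⊕ shift (2 + 3 * m) (lhsFamily 2 m))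
  step₂ m n = begin
    lhsFamily 2 (suc m) n
      ≡⟨ chainCount-+ (2 ≡ᵇ_) (3 ≤ᵇ_) (2 ≤ᵇ_) m (split-≤ᵇ 2) n ⟨
    chainCount (2 ≡ᵇ_) (suc m) n +z lhsFamily 3 (suc m) n
      ≡⟨ cong (_+z lhsFamily 3 (suc m) n) (trans (chainCount-≡ᵇ 1 m n)
           (shift-cong 2 (λ k → trans (chainCount-cong m gapOKᵇ-2 k) (lhsFamily-+3 1 m k)) n)) ⟩
    shift 2 (shift (3 * m) (lhsFamily 2 m)) n +z lhsFamily 3 (suc m) n
      ≡⟨ cong (_+z lhsFamily 3 (suc m) n) (shift-shift 2 (3 * m) (lhsFamily 2 m) n) ⟩
    shift (2 + 3 * m) (lhsFamily 2 m) n +z lhsFamily 3 (suc m) n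
      ≡⟨ ZP.+-comm (shift (2 + 3 * m) (lhsFamily 2 m) n) (lhsFamily 3 (suc m) n) ⟩
    lhsFamily 3 (suc m) n +z shift (2 + 3 * m) (lhsFamily 2 m) n
      ∎
    where open ≡-Reasoning
  -- a first part 1 is followed by 3 (1 + 3 ≡ 1 mod 3) or by a part at least 5
  gapOKᵇ-1-split : ∀ m → (chainCount (gapOKᵇ 1) m ⊕ lhsFamily 4 m) ≈ (lhsFamily 3 m ⊕ lhsFamily 5 m)
  gapOKᵇ-1-split zero    zero    = refl
  gapOKᵇ-1-split zero    (suc k) = refl
  gapOKᵇ-1-split (suc m) k =
    trans (cong (_+z lhsFamily 4 (suc m) k) (sym (chainCount-+ (3 ≡ᵇ_) (5 ≤ᵇ_) (gapOKᵇ 1) m gapOKᵇ-1 k)))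
    (trans (regroup (chainCount (3 ≡ᵇ_) (suc m) k) (lhsFamily 5 (suc m) k) (lhsFamily 4 (suc m) k))
           (cong (_+z lhsFamily 5 (suc m) k) (chainCount-+ (3 ≡ᵇ_) (4 ≤ᵇ_) (3 ≤ᵇ_) m (split-≤ᵇ 3) k)))
    where
    regroup : ∀ (a b c : ℤ) → (a +z b) +z c ≡ (a +z c) +z b
    regroup = ℤ-Solver.solve-∀
  step₁ : ∀ m → (lhsFamily 1 (suc m) ⊕ shift (1 + 3 * m) (lhsFamily 1 m))
              ≈ ((lhsFamily 2 (suc m) ⊕ shift (1 + 3 * m) (lhsFamily 2 m)) ⊕ shift 1 (lhsFamily 3 m))
  step₁ m n = begin
    lhsFamily 1 (suc m) n +z A
      ≡⟨ cong (_+z A) (chainCount-+ (1 ≡ᵇ_) (2 ≤ᵇ_) (1 ≤ᵇ_) m (split-≤ᵇ 1) n) ⟨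
    (chainCount (1 ≡ᵇ_) (suc m) n +z lhsFamily 2 (suc m) n) +z A
      ≡⟨ cong (λ x → (x +z lhsFamily 2 (suc m) n) +z A) (chainCount-≡ᵇ 0 m n) ⟩
    (G +z lhsFamily 2 (suc m) n) +z A
      ≡⟨ regroup G (lhsFamily 2 (suc m) n) A (shift 1 (lhsFamily 3 m) n) B G+A≡ ⟩
    (lhsFamily 2 (suc m) n +z B) +z shift 1 (lhsFamily 3 m) n
      ∎
    where
    open ≡-Reasoning
    A : ℤ
    A = shift (1 + 3 * m) (lhsFamily 1 m) n
    B : ℤ
    B = shift (1 + 3 * m) (lhsFamily 2 m) n
    G : ℤ
    G = shift 1 (chainCount (gapOKᵇ 1) m) n
    G+A≡ : G +z A ≡ shift 1 (lhsFamily 3 m) n +z B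
    G+A≡ = begin
      G +z A
        ≡⟨ cong (G +z_) (trans (shift-cong 1 (lhsFamily-+3 0 m) n) (shift-shift 1 (3 * m) (lhsFamily 1 m) n)) ⟨
      G +z shift 1 (lhsFamily 4 m) n
        ≡⟨ shift-⊕ 1 (chainCount (gapOKᵇ 1) m) (lhsFamily 4 m) n ⟨
      shift 1 (chainCount (gapOKᵇ 1) m ⊕ lhsFamily 4 m) n
        ≡⟨ shift-cong 1 (gapOKᵇ-1-split m) n ⟩
      shift 1 (lhsFamily 3 m ⊕ lhsFamily 5 m) n
        ≡⟨ shift-⊕ 1 (lhsFamily 3 m) (lhsFamily 5 m) n ⟩
      shift 1 (lhsFamily 3 m) n +z shift 1 (lhsFamily 5 m) n
        ≡⟨ cong (shift 1 (lhsFamily 3 m) n +z_) (trans (shift-cong 1 (lhsFamily-+3 1 m) n) (shift-shift 1 (3 * m) (lhsFamily 2 m) n)) ⟩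
      shift 1 (lhsFamily 3 m) n +z B
        ∎
    regroup : ∀ (g f₂ a f₃ b : ℤ) → g +z a ≡ f₃ +z b → (g +z f₂) +z a ≡ (f₂ +z b) +z f₃
    regroup g f₂ a f₃ b g+a≡ = trans (swap g f₂ a) (trans (cong (f₂ +z_) g+a≡) (rotate f₂ f₃ b))
      where
      swap : ∀ (g f₂ a : ℤ) → (g +z f₂) +z a ≡ f₂ +z (g +z a)
      swap = ℤ-Solver.solve-∀
      rotate : ∀ (f₂ f₃ b : ℤ) → f₂ +z (f₃ +z b) ≡ (f₂ +z b) +z f₃
      rotate = ℤ-Solver.solve-∀

theorem11 : (m n : ℕ) → lhsCoeffX m n ≡ rhsCoeffX m n
theorem11 m n = begin
  lhsCoeffX m n                ≡⟨ lhsCoeffX≡chainCount m n ⟩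
  chainCount (λ _ → true) m n  ≡⟨ chainCount-true≈lhsFamily-1 m n ⟩
  lhsFamily 1 m n              ≡⟨ proj₁ (qDiffSystem-unique lhsFamily-qDiffSystem rhsFamily-qDiffSystem m) n ⟩
  rhsFamily 0 0 m n            ≡⟨ rhsCoeffX≈rhsFamily m n ⟨
  rhsCoeffX m n                ∎
  where open ≡-Reasoning
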